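{- Let $q$ be an odd prime power with $q\ge5$. Then $\mathrm{P\Gamma L}(2,q)$, in its primitive action of degree $q(q+1)/2$ (on the external points of a nonsingular conic in $\mathrm{PG}(2,q)$), is nonseparating, and hence nonspreading.
   Context: A transitive group $G$ on a finite set $\Omega$ is nonseparating if there exist subsets $A,B\subseteq\Omega$ with $|A|,|B|\ge2$, $|A||B|=|\Omega|$ and $|A\cap B^g|=1$ for all $g\in G$. Call a vector with non-negative entries (or the set/multiset it is the multiplicity vector $\chi$ of) nontrivial if it has at least two distinct entries and at most $|\Omega|-2$ zero entries. $G$ is nonspreading if there exist a nontrivial multiset $A$ of elements of $\Omega$, a nontrivial subset $B\subseteq\Omega$ and a positive integer $\lambda$ with $|A|$ dividing $|\Omega|$ and $\chi_A\cdot\chi_{B^g}=\lambda$ for all $g\in G$. An external point of a nonsingular conic is a point of the plane lying on two tangent lines of the conic. -}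

module Defs where

open import Data.Nat using (ℕ; zero; suc; _+_; _*_; _≤_; _<_)
open import Data.Bool using (Bool; true; false; _∧_; if_then_else_)
open import Data.Product using (Σ; _×_; _,_; ∃-syntax)
open import Data.List using (List; []; _∷_; length; map; concatMap)
open import Data.Nat.ListAction using (sum)
open import Data.Bool.ListAction using (any)
open import Data.List.Membership.Propositional using (_∈_)
open import Data.List.Relation.Unary.Unique.Propositional using (Unique)
open import Relation.Nullary using (¬_; Dec; yes; no; does)
open import Relation.Binary.PropositionalEquality using (_≡_; _≢_)
open import Data.Product.Properties using (≡-dec)
open import Data.Bool using (not)
open import Data.Nat using (_≤ᵇ_) renaming (_≡ᵇ_ to _==ℕ_)
open import Data.Nat.Divisibility using (_∣_)

filterB : {A : Set} → (A → Bool) → List A → List A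
filterB p [] = []
filterB p (x ∷ xs) = if p x then x ∷ filterB p xs else filterB p xs

countB : {A : Set} → (A → Bool) → List A → ℕ
countB p xs = length (filterB p xs)


record FiniteField : Set₁ where
  infixl 6 _+F_
  infixl 7 _*F_
  field
    Carrier : Set
    _≟F_    : (x y : Carrier) → Dec (x ≡ y)
    0F 1F   : Carrier
    _+F_ _*F_ : Carrier → Carrier → Carrier
    -F_     : Carrier → Carrier
    invF    : Carrier → Carrier
    +-assoc : ∀ x y z → (x +F y) +F z ≡ x +F (y +F z)
    +-comm  : ∀ x y → x +F y ≡ y +F x
    +-idˡ   : ∀ x → 0F +F x ≡ x
    +-invˡ  : ∀ x → (-F x) +F x ≡ 0F
    *-assoc : ∀ x y z → (x *F y) *F z ≡ x *F (y *F z)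
    *-comm  : ∀ x y → x *F y ≡ y *F x
    *-idˡ   : ∀ x → 1F *F x ≡ x
    distribˡ : ∀ x y z → x *F (y +F z) ≡ (x *F y) +F (x *F z)
    0≢1     : 0F ≢ 1F
    *-invʳ  : ∀ x → x ≢ 0F → x *F invF x ≡ 1F
    elems    : List Carrier
    complete : ∀ x → x ∈ elems
    unique   : Unique elems

  order : ℕ
  order = length elems

module PG2 (𝔽 : FiniteField) where
  open FiniteField 𝔽

  F : Set
  F = Carrier

  -- vectors of F³ (homogeneous coordinates of PG(2,F), or line coordinates)
  V : Set
  V = F × F × F

  _≟V_ : (u v : V) → Dec (u ≡ v)
  _≟V_ = ≡-dec _≟F_ (≡-dec _≟F_ _≟F_)

  _==F_ : F → F → Bool
  x ==F y = does (x ≟F y)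

  _==V_ : V → V → Bool
  u ==V v = does (u ≟V v)

  zeroV : V
  zeroV = 0F , 0F , 0F

  scale : F → V → V
  scale c (a , b , d) = c *F a , c *F b , c *F d

  normalize : V → V
  normalize (a , b , c) =
    if not (a ==F 0F) then scale (invF a) (a , b , c) else
    (if not (b ==F 0F) then scale (invF b) (a , b , c) else
    (if not (c ==F 0F) then scale (invF c) (a , b , c) else (a , b , c)))

  allV : List V
  allV = concatMap (λ a → concatMap (λ b → map (λ c → a , b , c) elems) elems) elems

  -- the points of PG(2,F), one canonical representative each
  -- (also used as the coordinates of the lines of PG(2,F))
  points : List V
  points = filterB (λ v → not (v ==V zeroV) ∧ (normalize v ==V v)) allV

  dotV : V → V → F
  dotV (a , b , c) (a' , b' , c') = (a *F a') +F ((b *F b') +F (c *F c'))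

  incident : V → V → Bool
  incident l p = dotV l p ==F 0F

  onConic : V → Bool
  onConic (a , b , c) = (a *F c) ==F (b *F b)

  isTangent : V → Bool
  isTangent l = countB (λ p → onConic p ∧ incident l p) points ==ℕ 1

  isExternal : V → Bool
  isExternal p = 2 ≤ᵇ countB (λ l → isTangent l ∧ incident l p) points

  Ω : List V
  Ω = filterB isExternal points

  record FieldAut : Set where
    field
      σ      : F → F
      σ-+    : ∀ x y → σ (x +F y) ≡ σ x +F σ y
      σ-*    : ∀ x y → σ (x *F y) ≡ σ x *F σ y
      σ-1    : σ 1F ≡ 1F
      σ-inj  : ∀ x y → σ x ≡ σ y → x ≡ y
      σ-surj : ∀ y → ∃[ x ] σ x ≡ y

  -- 3×3 matrices, given by their rows
  Mat : Set
  Mat = V × V × V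

  mulMV : Mat → V → V
  mulMV (r₀ , r₁ , r₂) v = dotV r₀ v , dotV r₁ v , dotV r₂ v

  det : Mat → F
  det ((a , b , c) , (d , e , f) , (g , h , i)) =
    ((a *F ((e *F i) +F (-F (f *F h))))
      +F (-F (b *F ((d *F i) +F (-F (f *F g))))))
      +F (c *F ((d *F h) +F (-F (e *F g))))

  act : FieldAut → Mat → V → V
  act τ M (a , b , c) = normalize (mulMV M (σ a , σ b , σ c))
    where open FieldAut τ

  -- elements of G = PΓL(2,q), realised as the collineations of PG(2,q)
  -- (semilinear maps with invertible matrix) stabilising the conic C
  record GElt : Set where
    field
      aut   : FieldAut
      mat   : Mat
      invertible : det mat ≢ 0F
      preservesC : ∀ p → p ∈ points → onConic p ≡ true →
                   onConic (act aut mat p) ≡ true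

  actG : GElt → V → V
  actG g = act (GElt.aut g) (GElt.mat g)

  Subset : Set
  Subset = V → Bool

  Multiset : Set
  Multiset = V → ℕ

  card : Subset → ℕ
  card A = countB A Ω

  msize : Multiset → ℕ
  msize A = sum (map A Ω)

  imageSet : GElt → Subset → Subset
  imageSet g B x = any (λ b → B b ∧ (actG g b ==V x)) Ω

  χ : Subset → Multiset
  χ B x = if B x then 1 else 0

  dotΩ : Multiset → Multiset → ℕ
  dotΩ A B = sum (map (λ x → A x * B x) Ω)

  Nontrivial : Multiset → Set
  Nontrivial A =
    (∃[ x ] ∃[ y ] (x ∈ Ω × y ∈ Ω × A x ≢ A y))
    × (countB (λ x → A x ==ℕ 0) Ω + 2 ≤ length Ω)

  Nonseparating : Set
  Nonseparating =
    ∃[ A ] ∃[ B ] (2 ≤ card A × 2 ≤ card B × card A * card B ≡ length Ω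
      × (∀ (g : GElt) → countB (λ x → A x ∧ imageSet g B x) Ω ≡ 1))

  Nonspreading : Set
  Nonspreading =
    ∃[ A ] ∃[ B ] ∃[ λ' ] (Nontrivial A × Nontrivial (χ B) × 0 < λ'
      × msize A ∣ length Ω
      × (∀ (g : GElt) → dotΩ A (χ (imageSet g B)) ≡ λ'))

module Submission where

-- Take for B the q external points on the
-- tangent X₀ = 0 at (0, 0, 1), and for A the (q - 1)/2 external points on the secant X₁ = 0
-- together with its pole (0, 1, 0); then |A||B| = q(q + 1)/2. A collineation stabilising
-- the conic maps tangents to tangents and external points to external points, so every B^g
-- is the set of external points of some tangent, and each tangent contains exactly one
-- point of A: the pole if the tangent passes through it, otherwise its intersection with
-- the secant. Nonspreading follows with the multiset χ_A and λ = 1.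

open import Defs
open import Data.Nat using (_≤_; _%_)
open import Data.Product using (_×_)
open import Relation.Binary.PropositionalEquality using (_≡_)

open import Algebra using (CommutativeRing)
import Algebra.Properties.CommutativeSemigroup
open import Algebra.Solver.Ring.AlmostCommutativeRing using (_-Raw-AlmostCommutative⟶_; fromCommutativeRing)
open import Data.Bool using (Bool; true; false; T; not; _∧_; _∨_; if_then_else_)
open import Data.Bool.ListAction using (any)
open import Data.Bool.Properties using (T-≡; T-∧; T-∨; ∧-identityʳ)
open import Data.Empty using (⊥-elim)
open import Data.Integer as ℤ using (ℤ; -[1+_]; _⊖_; _◃_; sign; ∣_∣; 0ℤ; 1ℤ)
open import Data.Integer.Properties using ([1+m]⊖[1+n]≡m⊖n)
open import Data.List using (List; []; _∷_; length; map; concatMap; _++_)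
open import Data.List.Membership.Propositional using (_∈_; find; lose)
open import Data.List.Membership.Propositional.Properties using (∈-map⁺; ∈-map⁻)
open import Data.List.Properties using (length-map)
open import Data.List.Relation.Binary.Subset.Propositional using (_⊆_)
open import Data.List.Relation.Unary.All as All using (All; []; _∷_)
open import Data.List.Relation.Unary.AllPairs using ([]; _∷_)
open import Data.List.Relation.Unary.Any using (here; there; any?)
open import Data.List.Relation.Unary.Any.Properties using (any⁺; any⁻; ++⁺ˡ; ++⁺ʳ; ++⁻)
open import Data.List.Relation.Unary.Unique.Propositional using (Unique)
import Data.List.Relation.Unary.Unique.Propositional.Properties as Unique
open import Data.Maybe as Maybe using (Maybe)
open import Data.Nat as ℕ using (ℕ; zero; suc; _+_; _*_; s≤s; z≤n)
open import Data.Nat.Divisibility using (_∣_; _∣0; ∣m∣n⇒∣m+n; ∣-refl; n∣m⇒m%n≡0; m∣m*n)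
open import Data.Nat.ListAction using (sum)
import Data.Nat.Properties as ℕ
open import Data.Product using (∃-syntax; _,_; proj₁; proj₂)
open import Data.Sign as Sign using (Sign)
open import Data.Sum using (_⊎_; inj₁; inj₂)
open import Function using (_∘′_; Equivalence)
open import Level using (0ℓ)
import Relation.Binary.PropositionalEquality as ≡
open import Relation.Binary.PropositionalEquality
  using (_≢_; refl; sym; trans; cong; cong₂; subst; subst₂; module ≡-Reasoning)
open import Relation.Nullary using (Dec; yes; no; does; ¬_; dec⇒maybe)

open Equivalence using (to; from)
open Algebra.Properties.CommutativeSemigroup ℕ.+-commutativeSemigroup using (interchange)

T-does⁺ : {P : Set} (p? : Dec P) → P → T (does p?)
T-does⁺ (yes _) _ = _
T-does⁺ (no ¬p) p = ¬p p

T-does⁻ : {P : Set} (p? : Dec P) → T (does p?) → P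
T-does⁻ (yes p) _ = p

T-not-does⁺ : {P : Set} (p? : Dec P) → ¬ P → T (not (does p?))
T-not-does⁺ (yes p) ¬p = ¬p p
T-not-does⁺ (no _)  _  = _

T-not-does⁻ : {P : Set} (p? : Dec P) → T (not (does p?)) → ¬ P
T-not-does⁻ (no ¬p) _ = ¬p

bool-ext : {a b : Bool} → (T a → T b) → (T b → T a) → a ≡ b
bool-ext {false} {false} _ _ = refl
bool-ext {false} {true}  _ g = ⊥-elim (g _)
bool-ext {true}  {false} f _ = ⊥-elim (f _)
bool-ext {true}  {true}  _ _ = refl

χ≡1 : ∀ {a} → T a → (if a then 1 else 0) ≡ 1
χ≡1 {true} _ = refl

χ≡0 : ∀ {a} → ¬ T a → (if a then 1 else 0) ≡ 0
χ≡0 {true}  ¬a = ⊥-elim (¬a _)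
χ≡0 {false} _  = refl

module _ {A : Set} where

  ∈-filterB⁺ : ∀ (p : A → Bool) {x xs} → x ∈ xs → T (p x) → x ∈ filterB p xs
  ∈-filterB⁺ p {xs = y ∷ ys} (here refl) px with p y
  ... | true = here refl
  ∈-filterB⁺ p {xs = y ∷ ys} (there x∈ys) px with p y
  ... | true  = there (∈-filterB⁺ p x∈ys px)
  ... | false = ∈-filterB⁺ p x∈ys px

  ∈-filterB⁻ : ∀ (p : A → Bool) {x} xs → x ∈ filterB p xs → x ∈ xs × T (p x)
  ∈-filterB⁻ p (y ∷ ys) x∈ with p y in eq
  ∈-filterB⁻ p (y ∷ ys) (here refl) | true = here refl , subst T (sym eq) _
  ∈-filterB⁻ p (y ∷ ys) (there x∈) | true = let x∈ys , px = ∈-filterB⁻ p ys x∈ in there x∈ys , px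
  ∈-filterB⁻ p (y ∷ ys) x∈ | false = let x∈ys , px = ∈-filterB⁻ p ys x∈ in there x∈ys , px

  filterB-Unique : ∀ (p : A → Bool) {xs} → Unique xs → Unique (filterB p xs)
  filterB-Unique p {[]} [] = []
  filterB-Unique p {x ∷ xs} (x∉xs ∷ u) with p x
  ... | true  = All.tabulate (λ y∈ → All.lookup x∉xs (proj₁ (∈-filterB⁻ p xs y∈)))
                ∷ filterB-Unique p u
  ... | false = filterB-Unique p u

  countB-∷ : ∀ (p : A → Bool) x xs → countB p (x ∷ xs) ≡ (if p x then 1 else 0) + countB p xs
  countB-∷ p x xs with p x
  ... | true  = refl
  ... | false = refl

  countB-cong : ∀ {p q : A → Bool} xs → (∀ {x} → x ∈ xs → p x ≡ q x) → countB p xs ≡ countB q xs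
  countB-cong [] _ = refl
  countB-cong {p} {q} (x ∷ xs) p≡q = begin
    countB p (x ∷ xs)                          ≡⟨ countB-∷ p x xs ⟩
    (if p x then 1 else 0) + countB p xs       ≡⟨ cong₂ (λ b n → (if b then 1 else 0) + n)
                                                        (p≡q (here refl)) (countB-cong xs (p≡q ∘′ there)) ⟩
    (if q x then 1 else 0) + countB q xs       ≡⟨ countB-∷ q x xs ⟨
    countB q (x ∷ xs)                          ∎
    where open ≡-Reasoning

  countB≡0 : ∀ (p : A → Bool) xs → (∀ {x} → x ∈ xs → ¬ T (p x)) → countB p xs ≡ 0
  countB≡0 p [] _ = refl
  countB≡0 p (x ∷ xs) ¬p
    rewrite countB-∷ p x xs | χ≡0 (¬p (here refl)) = countB≡0 p xs (¬p ∘′ there)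

  countB≡1 : ∀ (p : A → Bool) {x xs} → Unique xs → x ∈ xs → T (p x) →
             (∀ {y} → y ∈ xs → T (p y) → y ≡ x) → countB p xs ≡ 1
  countB≡1 p {xs = y ∷ ys} (y∉ys ∷ u) (here refl) px only
    rewrite countB-∷ p y ys | χ≡1 px =
    cong suc (countB≡0 p ys (λ z∈ pz → All.lookup y∉ys z∈ (sym (only (there z∈) pz))))
  countB≡1 p {xs = y ∷ ys} (y∉ys ∷ u) (there x∈) px only
    rewrite countB-∷ p y ys | χ≡0 {p y} (λ py → All.lookup y∉ys x∈ (only (here refl) py)) =
    countB≡1 p u x∈ px (only ∘′ there)

  countB≡0⊎∃ : ∀ (p : A → Bool) xs → countB p xs ≡ 0 ⊎ ∃[ x ] x ∈ xs × T (p x)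
  countB≡0⊎∃ p [] = inj₁ refl
  countB≡0⊎∃ p (x ∷ xs) with p x in eq
  ... | true  = inj₂ (x , here refl , subst T (sym eq) _)
  ... | false with countB≡0⊎∃ p xs
  ...   | inj₁ empty = inj₁ empty
  ...   | inj₂ (y , y∈ , py) = inj₂ (y , there y∈ , py)

  countB-mono-∷ : ∀ (p : A → Bool) x xs → countB p xs ≤ countB p (x ∷ xs)
  countB-mono-∷ p x xs with p x
  ... | true  = ℕ.n≤1+n _
  ... | false = ℕ.≤-refl

  1≤countB : ∀ (p : A → Bool) {x} xs → x ∈ xs → T (p x) → 1 ≤ countB p xs
  1≤countB p (y ∷ ys) (here refl) px rewrite countB-∷ p y ys | χ≡1 px = s≤s z≤n
  1≤countB p (y ∷ ys) (there x∈) px = ℕ.≤-trans (1≤countB p ys x∈ px) (countB-mono-∷ p y ys)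

  1≤countB⁻ : ∀ (p : A → Bool) xs → 1 ≤ countB p xs → ∃[ x ] x ∈ xs × T (p x)
  1≤countB⁻ p (x ∷ xs) c with p x in eq
  ... | true  = x , here refl , subst T (sym eq) _
  ... | false = let y , y∈ , py = 1≤countB⁻ p xs c in y , there y∈ , py

  countB≡1⁻ : ∀ (p : A → Bool) xs → countB p xs ≡ 1 →
              ∃[ x ] x ∈ xs × T (p x) × (∀ {y} → y ∈ xs → T (p y) → y ≡ x)
  countB≡1⁻ p (x ∷ xs) c with p x in eq
  ... | true  = x , here refl , subst T (sym eq) _ , only
    where
    only : ∀ {y} → y ∈ x ∷ xs → T (p y) → y ≡ x
    only (here refl) _  = refl
    only (there y∈) py = ⊥-elim (ℕ.<-irrefl (sym (ℕ.suc-injective c)) (1≤countB p xs y∈ py))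
  ... | false = let z , z∈ , pz , only = countB≡1⁻ p xs c in
    z , there z∈ , pz , λ { (here refl) py → ⊥-elim (subst T eq py) ; (there y∈) py → only y∈ py }

  2≤countB : ∀ (p : A → Bool) {x y} xs → x ∈ xs → y ∈ xs → x ≢ y → T (p x) → T (p y) →
             2 ≤ countB p xs
  2≤countB p (z ∷ zs) (here refl) (here refl) x≢y _ _ = ⊥-elim (x≢y refl)
  2≤countB p (z ∷ zs) (here refl) (there y∈) _ px py
    rewrite countB-∷ p z zs | χ≡1 px = s≤s (1≤countB p zs y∈ py)
  2≤countB p (z ∷ zs) (there x∈) (here refl) _ px py
    rewrite countB-∷ p z zs | χ≡1 py = s≤s (1≤countB p zs x∈ px)
  2≤countB p (z ∷ zs) (there x∈) (there y∈) x≢y px py =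
    ℕ.≤-trans (2≤countB p zs x∈ y∈ x≢y px py) (countB-mono-∷ p z zs)

  2≤countB⁻ : ∀ (p : A → Bool) xs → Unique xs → 2 ≤ countB p xs →
              ∃[ x ] ∃[ y ] x ∈ xs × y ∈ xs × x ≢ y × T (p x) × T (p y)
  2≤countB⁻ p (z ∷ zs) (z∉zs ∷ u) c with p z in eq
  ... | true  = let y , y∈ , py = 1≤countB⁻ p zs (ℕ.s≤s⁻¹ c) in
    z , y , here refl , there y∈ , All.lookup z∉zs y∈ , subst T (sym eq) _ , py
  ... | false = let x , y , x∈ , y∈ , x≢y , px , py = 2≤countB⁻ p zs u c in
    x , y , there x∈ , there y∈ , x≢y , px , py

  countB-++ : ∀ (p : A → Bool) xs ys → countB p (xs ++ ys) ≡ countB p xs + countB p ys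
  countB-++ p [] ys = refl
  countB-++ p (x ∷ xs) ys
    rewrite countB-∷ p x (xs ++ ys) | countB-∷ p x xs | countB-++ p xs ys =
    sym (ℕ.+-assoc (if p x then 1 else 0) _ _)

  countB-filterB : ∀ (p q : A → Bool) xs → countB q (filterB p xs) ≡ countB (λ x → p x ∧ q x) xs
  countB-filterB p q [] = refl
  countB-filterB p q (x ∷ xs) with p x
  ... | false = countB-filterB p q xs
  ... | true with q x
  ...   | true  = cong suc (countB-filterB p q xs)
  ...   | false = countB-filterB p q xs

  countB+countB-not : ∀ (p : A → Bool) xs → countB p xs + countB (not ∘′ p) xs ≡ length xs
  countB+countB-not p [] = refl
  countB+countB-not p (x ∷ xs) with p x
  ... | true  = cong suc (countB+countB-not p xs)
  ... | false = trans (ℕ.+-suc _ _) (cong suc (countB+countB-not p xs))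

  countB-const-true : ∀ (xs : List A) → countB (λ _ → true) xs ≡ length xs
  countB-const-true [] = refl
  countB-const-true (x ∷ xs) = cong suc (countB-const-true xs)

  sum-cong : ∀ {f g : A → ℕ} xs → (∀ {x} → x ∈ xs → f x ≡ g x) → sum (map f xs) ≡ sum (map g xs)
  sum-cong [] _ = refl
  sum-cong (x ∷ xs) f≡g = cong₂ _+_ (f≡g (here refl)) (sum-cong xs (f≡g ∘′ there))

  sum-const : ∀ k (xs : List A) → sum (map (λ _ → k) xs) ≡ length xs * k
  sum-const k [] = refl
  sum-const k (x ∷ xs) = cong (k +_) (sum-const k xs)

  sum≡0 : ∀ (f : A → ℕ) xs → (∀ {x} → x ∈ xs → f x ≡ 0) → sum (map f xs) ≡ 0
  sum≡0 f [] _ = refl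
  sum≡0 f (x ∷ xs) f≡0 rewrite f≡0 (here refl) = sum≡0 f xs (f≡0 ∘′ there)

  sum-single : ∀ (f : A → ℕ) {x₀} xs → Unique xs → x₀ ∈ xs →
               (∀ {x} → x ∈ xs → x ≢ x₀ → f x ≡ 0) → sum (map f xs) ≡ f x₀
  sum-single f (x ∷ xs) (x∉xs ∷ _) (here refl) f≡0 =
    trans (cong (f x +_) (sum≡0 f xs (λ y∈ → f≡0 (there y∈) (All.lookup x∉xs y∈ ∘′ sym))))
          (ℕ.+-identityʳ _)
  sum-single f (x ∷ xs) (x∉xs ∷ u) (there x₀∈) f≡0 =
    cong₂ _+_ (f≡0 (here refl) (All.lookup x∉xs x₀∈)) (sum-single f xs u x₀∈ (f≡0 ∘′ there))

  sum-χ : ∀ (p : A → Bool) xs → sum (map (λ x → if p x then 1 else 0) xs) ≡ countB p xs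
  sum-χ p [] = refl
  sum-χ p (x ∷ xs) rewrite countB-∷ p x xs = cong ((if p x then 1 else 0) +_) (sum-χ p xs)

  sum-χ*χ : ∀ (p q : A → Bool) xs →
            sum (map (λ x → (if p x then 1 else 0) * (if q x then 1 else 0)) xs)
              ≡ countB (λ x → p x ∧ q x) xs
  sum-χ*χ p q xs = trans (sum-cong xs (λ {x} _ → χ*χ (p x) (q x))) (sum-χ (λ x → p x ∧ q x) xs)
    where
    χ*χ : ∀ a b → (if a then 1 else 0) * (if b then 1 else 0) ≡ (if a ∧ b then 1 else 0)
    χ*χ true  true  = refl
    χ*χ true  false = refl
    χ*χ false _     = refl

  any-intro : ∀ (p : A → Bool) {x xs} → x ∈ xs → T (p x) → T (any p xs)
  any-intro p x∈ px = any⁺ p (lose x∈ px)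

  any-elim : ∀ (p : A → Bool) xs → T (any p xs) → ∃[ x ] x ∈ xs × T (p x)
  any-elim p xs t = find (any⁻ p xs t)

module _ {A B : Set} where

  countB-map : ∀ (p : B → Bool) (f : A → B) xs → countB p (map f xs) ≡ countB (p ∘′ f) xs
  countB-map p f [] = refl
  countB-map p f (x ∷ xs) rewrite countB-∷ p (f x) (map f xs) | countB-∷ (p ∘′ f) x xs
    | countB-map p f xs = refl

  countB-concatMap : ∀ (p : B → Bool) (f : A → List B) xs →
                     countB p (concatMap f xs) ≡ sum (map (λ x → countB p (f x)) xs)
  countB-concatMap p f [] = refl
  countB-concatMap p f (x ∷ xs)
    rewrite countB-++ p (f x) (concatMap f xs) | countB-concatMap p f xs = refl

  ∈-concatMap⁺ : ∀ (f : A → List B) {x y xs} → y ∈ f x → x ∈ xs → y ∈ concatMap f xs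
  ∈-concatMap⁺ f y∈ (here refl) = ++⁺ˡ y∈
  ∈-concatMap⁺ f {xs = z ∷ zs} y∈ (there x∈) = ++⁺ʳ (f z) (∈-concatMap⁺ f y∈ x∈)

  ∈-concatMap⁻ : ∀ (f : A → List B) {y} xs → y ∈ concatMap f xs → ∃[ x ] x ∈ xs × y ∈ f x
  ∈-concatMap⁻ f (z ∷ zs) y∈ with ++⁻ (f z) y∈
  ... | inj₁ y∈fz = z , here refl , y∈fz
  ... | inj₂ y∈zs = let x , x∈ , y∈fx = ∈-concatMap⁻ f zs y∈zs in x , there x∈ , y∈fx

  concatMap-Unique : ∀ (f : A → List B) {xs} → Unique xs → (∀ x → Unique (f x)) →
                     (∀ {x x′ y} → y ∈ f x → y ∈ f x′ → x ≡ x′) → Unique (concatMap f xs)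
  concatMap-Unique f [] _ _ = []
  concatMap-Unique f {x ∷ xs} (x∉xs ∷ u) uf disjoint =
    Unique.++⁺ (uf x) (concatMap-Unique f u uf disjoint) λ (y∈fx , y∈rest) →
      let x′ , x′∈ , y∈fx′ = ∈-concatMap⁻ f xs y∈rest in All.lookup x∉xs x′∈ (disjoint y∈fx y∈fx′)

module _ {A : Set} where

  private
    remove : ∀ {x : A} ys → x ∈ ys →
             ∃[ ys′ ] length ys ≡ suc (length ys′) × (∀ {z} → z ∈ ys → z ≢ x → z ∈ ys′)
    remove (y ∷ ys) (here refl) =
      ys , refl , λ { (here refl) z≢x → ⊥-elim (z≢x refl) ; (there z∈) _ → z∈ }
    remove (y ∷ ys) (there x∈) =
      let ys′ , len , keep = remove ys x∈ in
      y ∷ ys′ , cong suc len , λ { (here refl) _ → here refl ; (there z∈) z≢x → there (keep z∈ z≢x) }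

  Unique-⊆⇒length≤ : ∀ {xs ys : List A} → Unique xs → xs ⊆ ys → length xs ≤ length ys
  Unique-⊆⇒length≤ {[]} _ _ = z≤n
  Unique-⊆⇒length≤ {x ∷ xs} {ys} (x∉xs ∷ u) xs⊆ys =
    let ys′ , len , keep = remove ys (xs⊆ys (here refl)) in
    subst (suc (length xs) ≤_) (sym len)
      (s≤s (Unique-⊆⇒length≤ u λ z∈ → keep (xs⊆ys (there z∈)) λ { refl → All.lookup x∉xs z∈ refl }))

  Unique-⊆-⊇⇒length≡ : ∀ {xs ys : List A} → Unique xs → Unique ys →
                        xs ⊆ ys → ys ⊆ xs → length xs ≡ length ys
  Unique-⊆-⊇⇒length≡ ux uy xs⊆ys ys⊆xs =
    ℕ.≤-antisym (Unique-⊆⇒length≤ ux xs⊆ys) (Unique-⊆⇒length≤ uy ys⊆xs)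

  map-Unique : ∀ (f : A → A) {xs} → Unique xs → (∀ {x y} → x ∈ xs → y ∈ xs → f x ≡ f y → x ≡ y) →
               Unique (map f xs)
  map-Unique f [] _ = []
  map-Unique f {x ∷ xs} (x∉xs ∷ u) inj =
    All.tabulate (λ z∈ fx≡z → let y , y∈ , z≡fy = ∈-map⁻ f z∈ in
                               All.lookup x∉xs y∈ (inj (here refl) (there y∈) (trans fx≡z z≡fy)))
    ∷ map-Unique f u (λ x∈ y∈ → inj (there x∈) (there y∈))

  pigeonhole : (_≟_ : (x y : A) → Dec (x ≡ y)) (f : A → A) {xs : List A} → Unique xs →
               (∀ {x} → x ∈ xs → f x ∈ xs) → (∀ {x y} → x ∈ xs → y ∈ xs → f x ≡ f y → x ≡ y) →
               ∀ {y} → y ∈ xs → ∃[ x ] x ∈ xs × f x ≡ y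
  pigeonhole _≟_ f {xs} u into inj {y} y∈ with any? (y ≟_) (map f xs)
  ... | yes y∈image = let x , x∈ , y≡fx = ∈-map⁻ f y∈image in x , x∈ , sym y≡fx
  ... | no y∉image = ⊥-elim (ℕ.<-irrefl refl (begin-strict
      length xs              ≡⟨ length-map f xs ⟨
      length (map f xs)      <⟨ Unique-⊆⇒length≤ (y∉image′ ∷ map-Unique f u inj) y∷image⊆xs ⟩
      length xs              ∎))
    where
    open ℕ.≤-Reasoning
    y∉image′ : All (y ≢_) (map f xs)
    y∉image′ = All.tabulate (λ z∈ y≡z → y∉image (subst (_∈ map f xs) (sym y≡z) z∈))
    y∷image⊆xs : y ∷ map f xs ⊆ xs
    y∷image⊆xs (here refl) = y∈
    y∷image⊆xs (there z∈) = let x , x∈ , z≡fx = ∈-map⁻ f z∈ in subst (_∈ xs) (sym z≡fx) (into x∈)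

  countB-involution : ∀ (p : A → Bool) (φ : A → A) {xs} → Unique xs → (∀ x → x ∈ xs) →
                      (∀ x → φ (φ x) ≡ x) → countB (p ∘′ φ) xs ≡ countB p xs
  countB-involution p φ {xs} u complete-xs φφ = begin
    length (filterB (p ∘′ φ) xs)          ≡⟨ length-map φ (filterB (p ∘′ φ) xs) ⟨
    length (map φ (filterB (p ∘′ φ) xs))  ≡⟨ Unique-⊆-⊇⇒length≡ u-image (filterB-Unique p u) image⊆ ⊆image ⟩
    length (filterB p xs)                 ∎
    where
    open ≡-Reasoning
    u-image : Unique (map φ (filterB (p ∘′ φ) xs))
    u-image = map-Unique φ (filterB-Unique _ u) λ {x} {y} _ _ φx≡φy →
      trans (sym (φφ x)) (trans (cong φ φx≡φy) (φφ y))
    image⊆ : map φ (filterB (p ∘′ φ) xs) ⊆ filterB p xs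
    image⊆ z∈ = let w , w∈ , z≡φw = ∈-map⁻ φ z∈ in
      ∈-filterB⁺ p (complete-xs _) (subst (T ∘′ p) (sym z≡φw) (proj₂ (∈-filterB⁻ _ xs w∈)))
    ⊆image : filterB p xs ⊆ map φ (filterB (p ∘′ φ) xs)
    ⊆image {z} z∈ = subst (_∈ map φ (filterB (p ∘′ φ) xs)) (φφ z)
      (∈-map⁺ φ (∈-filterB⁺ (p ∘′ φ) (complete-xs (φ z))
                  (subst (T ∘′ p) (sym (φφ z)) (proj₂ (∈-filterB⁻ p xs z∈)))))

module _ {A B : Set} (_≟_ : (x y : B) → Dec (x ≡ y)) (f : A → B) where

  fibre : B → List A → ℕ
  fibre y = countB (λ x → does (f x ≟ y))

  length≡sum-fibres : ∀ xs {ys} → Unique ys → (∀ {x} → x ∈ xs → f x ∈ ys) →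
                      length xs ≡ sum (map (λ y → fibre y xs) ys)
  length≡sum-fibres [] {ys} _ _ = sym (sum≡0 (λ y → fibre y []) ys (λ _ → refl))
  length≡sum-fibres (x ∷ xs) {ys} u into = sym (begin
    sum (map (λ y → fibre y (x ∷ xs)) ys)
      ≡⟨ sum-cong ys (λ {y} _ → countB-∷ (λ x → does (f x ≟ y)) x xs) ⟩
    sum (map (λ y → hit y + fibre y xs) ys)
      ≡⟨ sum-+ ys ⟩
    sum (map hit ys) + sum (map (λ y → fibre y xs) ys)
      ≡⟨ cong₂ _+_ (trans (sum-single hit ys u (into (here refl)) miss) (χ≡1 (T-does⁺ (f x ≟ f x) refl)))
                   (sym (length≡sum-fibres xs u (into ∘′ there))) ⟩
    suc (length xs) ∎)
    where
    open ≡-Reasoning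
    hit : B → ℕ
    hit y = if does (f x ≟ y) then 1 else 0
    miss : ∀ {y} → y ∈ ys → y ≢ f x → hit y ≡ 0
    miss _ y≢fx = χ≡0 (λ t → y≢fx (sym (T-does⁻ (f x ≟ _) t)))
    sum-+ : ∀ zs → sum (map (λ y → hit y + fibre y xs) zs)
                   ≡ sum (map hit zs) + sum (map (λ y → fibre y xs) zs)
    sum-+ [] = refl
    sum-+ (z ∷ zs) = trans (cong (hit z + fibre z xs +_) (sum-+ zs)) (interchange (hit z) _ _ _)

  even-fibres⇒even-length : ∀ xs {ys} → Unique ys → (∀ {x} → x ∈ xs → f x ∈ ys) →
                            (∀ y → 2 ∣ fibre y xs) → 2 ∣ length xs
  even-fibres⇒even-length xs {ys} u into even =
    subst (2 ∣_) (sym (length≡sum-fibres xs u into)) (sum-even ys)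
    where
    sum-even : ∀ zs → 2 ∣ sum (map (λ y → fibre y xs) zs)
    sum-even [] = 2 ∣0
    sum-even (z ∷ zs) = ∣m∣n⇒∣m+n (even z) (sum-even zs)

module _ (𝔽 : FiniteField) where

  open FiniteField 𝔽
  open PG2 𝔽

  infixl 6 _−_

  _−_ : F → F → F
  x − y = x +F (-F y)

  commutativeRing : CommutativeRing 0ℓ 0ℓ
  commutativeRing = record
    { Carrier = Carrier ; _≈_ = _≡_ ; _+_ = _+F_ ; _*_ = _*F_ ; -_ = -F_ ; 0# = 0F ; 1# = 1F
    ; isCommutativeRing = record
      { isRing = record
        { +-isAbelianGroup = record
          { isGroup = record
            { isMonoid = record
              { isSemigroup = record
                { isMagma = record { isEquivalence = ≡.isEquivalence ; ∙-cong = cong₂ _+F_ }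
                ; assoc = +-assoc }
              ; identity = +-idˡ , λ x → trans (+-comm x 0F) (+-idˡ x) }
            ; inverse = +-invˡ , λ x → trans (+-comm x (-F x)) (+-invˡ x)
            ; ⁻¹-cong = cong -F_ }
          ; comm = +-comm }
        ; *-cong = cong₂ _*F_
        ; *-assoc = *-assoc
        ; *-identity = *-idˡ , λ x → trans (*-comm x 1F) (*-idˡ x)
        ; distrib = distribˡ , λ x y z → trans (*-comm (y +F z) x)
                                           (trans (distribˡ x y z) (cong₂ _+F_ (*-comm x y) (*-comm x z))) }
      ; *-comm = *-comm } }

  open CommutativeRing commutativeRing
    using (ring; semiring; +-monoid; +-commutativeSemigroup; +-rawMonoid;
           +-identityʳ; -‿inverseʳ; zeroˡ; zeroʳ; *-identityʳ)
  open import Algebra.Properties.Ring ring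
    using (-‿distribˡ-*; -‿distribʳ-*; -‿involutive; -0#≈0#; -‿+-comm; x∙y⁻¹≈ε⇒x≈y; +-identityʳ-unique)
  open import Algebra.Definitions.RawMonoid +-rawMonoid using (_×′_)
  open import Algebra.Properties.Monoid.Mult.TCOptimised +-monoid using (1+×; ×-homo-+)
  open Algebra.Properties.CommutativeSemigroup +-commutativeSemigroup using () renaming (interchange to interchangeF)
  open import Algebra.Properties.Semiring.Mult.TCOptimised semiring using (×1-homo-*)

  -- Integer coefficients for the ring solver: unlike field elements, they can be
  -- compared by computation.
  ιℕ : ℕ → F
  ιℕ n = n ×′ 1F

  ι : ℤ → F
  ι (ℤ.+ n) = ιℕ n
  ι -[1+ n ] = -F ιℕ (suc n)

  private
    ι-⊖ : ∀ m n → ι (m ⊖ n) ≡ ιℕ m − ιℕ n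
    ι-⊖ m zero = sym (trans (cong (ιℕ m +F_) -0#≈0#) (+-identityʳ _))
    ι-⊖ zero (suc n) = sym (+-idˡ _)
    ι-⊖ (suc m) (suc n) = begin
      ι (suc m ⊖ suc n)                           ≡⟨ cong ι ([1+m]⊖[1+n]≡m⊖n m n) ⟩
      ι (m ⊖ n)                                   ≡⟨ ι-⊖ m n ⟩
      ιℕ m − ιℕ n                                ≡⟨ +-idˡ _ ⟨
      0F +F (ιℕ m − ιℕ n)                        ≡⟨ cong (_+F (ιℕ m − ιℕ n)) (-‿inverseʳ 1F) ⟨
      (1F − 1F) +F (ιℕ m − ιℕ n)                ≡⟨ interchangeF 1F (-F 1F) (ιℕ m) (-F ιℕ n) ⟩
      (1F +F ιℕ m) +F ((-F 1F) +F (-F ιℕ n))      ≡⟨ cong₂ _+F_ (1+× m 1F) (sym (-‿+-comm 1F (ιℕ n))) ⟨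
      ιℕ (suc m) +F (-F (1F +F ιℕ n))             ≡⟨ cong (λ a → ιℕ (suc m) − a) (1+× n 1F) ⟨
      ιℕ (suc m) − ιℕ (suc n)                    ∎
      where open ≡-Reasoning

    ι-+ : ∀ i j → ι (i ℤ.+ j) ≡ ι i +F ι j
    ι-+ (ℤ.+ m) (ℤ.+ n) = ×-homo-+ 1F m n
    ι-+ (ℤ.+ m) -[1+ n ] = ι-⊖ m (suc n)
    ι-+ -[1+ m ] (ℤ.+ n) = trans (ι-⊖ n (suc m)) (+-comm _ _)
    ι-+ -[1+ m ] -[1+ n ] = begin
      -F ιℕ (suc (suc (m ℕ.+ n)))             ≡⟨ cong (λ k → -F ιℕ (suc k)) (ℕ.+-suc m n) ⟨
      -F ιℕ (suc m ℕ.+ suc n)                 ≡⟨ cong -F_ (×-homo-+ 1F (suc m) (suc n)) ⟩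
      -F (ιℕ (suc m) +F ιℕ (suc n))           ≡⟨ -‿+-comm _ _ ⟨
      (-F ιℕ (suc m)) +F (-F ιℕ (suc n))      ∎
      where open ≡-Reasoning

    signed : Sign → F → F
    signed Sign.+ x = x
    signed Sign.- x = -F x

    ι-◃ : ∀ s n → ι (s ◃ n) ≡ signed s (ιℕ n)
    ι-◃ Sign.+ zero = refl
    ι-◃ Sign.- zero = sym -0#≈0#
    ι-◃ Sign.+ (suc n) = refl
    ι-◃ Sign.- (suc n) = refl

    ι≡signed : ∀ i → ι i ≡ signed (sign i) (ιℕ ∣ i ∣)
    ι≡signed (ℤ.+ n) = refl
    ι≡signed -[1+ n ] = refl

    signed-* : ∀ s t a b → signed (s Sign.* t) (a *F b) ≡ signed s a *F signed t b
    signed-* Sign.+ Sign.+ a b = refl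
    signed-* Sign.+ Sign.- a b = -‿distribʳ-* a b
    signed-* Sign.- Sign.+ a b = -‿distribˡ-* a b
    signed-* Sign.- Sign.- a b =
      trans (sym (-‿involutive _)) (trans (cong -F_ (-‿distribˡ-* a b)) (-‿distribʳ-* (-F a) b))

    ι-* : ∀ i j → ι (i ℤ.* j) ≡ ι i *F ι j
    ι-* i j = begin
      ι (s ◃ ∣ i ∣ ℕ.* ∣ j ∣)                                ≡⟨ ι-◃ s (∣ i ∣ ℕ.* ∣ j ∣) ⟩
      signed s (ιℕ (∣ i ∣ ℕ.* ∣ j ∣))                        ≡⟨ cong (signed s) (×1-homo-* ∣ i ∣ ∣ j ∣) ⟩
      signed s (ιℕ ∣ i ∣ *F ιℕ ∣ j ∣)                        ≡⟨ signed-* (sign i) (sign j) _ _ ⟩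
      signed (sign i) (ιℕ ∣ i ∣) *F signed (sign j) (ιℕ ∣ j ∣) ≡⟨ cong₂ _*F_ (ι≡signed i) (ι≡signed j) ⟨
      ι i *F ι j                                             ∎
      where
      open ≡-Reasoning
      s : Sign
      s = sign i Sign.* sign j

    ι-neg : ∀ i → ι (ℤ.- i) ≡ -F ι i
    ι-neg -[1+ n ] = sym (-‿involutive _)
    ι-neg (ℤ.+ zero) = sym -0#≈0#
    ι-neg (ℤ.+ suc n) = refl

    ι-morphism : ℤ.+-*-rawRing -Raw-AlmostCommutative⟶ fromCommutativeRing commutativeRing
    ι-morphism = record
      { ⟦_⟧ = ι ; +-homo = ι-+ ; *-homo = ι-* ; -‿homo = ι-neg ; 0-homo = refl ; 1-homo = refl }

    ι-≟ : ∀ i j → Maybe (ι i ≡ ι j)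
    ι-≟ i j = Maybe.map (cong ι) (dec⇒maybe (i ℤ.≟ j))

  open import Algebra.Solver.Ring ℤ.+-*-rawRing (fromCommutativeRing commutativeRing) ι-morphism ι-≟
    using (solve; _:=_; _:+_; _:-_; _:*_; :-_; con)

  1≢0 : 1F ≢ 0F
  1≢0 1≡0 = 0≢1 (sym 1≡0)

  *-invˡ : ∀ {x} → x ≢ 0F → invF x *F x ≡ 1F
  *-invˡ {x} x≢0 = trans (*-comm (invF x) x) (*-invʳ x x≢0)

  invF-nonzero : ∀ {x} → x ≢ 0F → invF x ≢ 0F
  invF-nonzero {x} x≢0 inv≡0 = 1≢0 (begin
    1F             ≡⟨ *-invʳ x x≢0 ⟨
    x *F invF x    ≡⟨ cong (x *F_) inv≡0 ⟩
    x *F 0F        ≡⟨ zeroʳ x ⟩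
    0F             ∎)
    where open ≡-Reasoning

  *-cancelˡ : ∀ {k x y} → k ≢ 0F → k *F x ≡ k *F y → x ≡ y
  *-cancelˡ {k} {x} {y} k≢0 kx≡ky = begin
    x                       ≡⟨ *-idˡ x ⟨
    1F *F x                 ≡⟨ cong (_*F x) (*-invˡ k≢0) ⟨
    (invF k *F k) *F x      ≡⟨ *-assoc _ _ _ ⟩
    invF k *F (k *F x)      ≡⟨ cong (invF k *F_) kx≡ky ⟩
    invF k *F (k *F y)      ≡⟨ *-assoc _ _ _ ⟨
    (invF k *F k) *F y      ≡⟨ cong (_*F y) (*-invˡ k≢0) ⟩
    1F *F y                 ≡⟨ *-idˡ y ⟩
    y                       ∎
    where open ≡-Reasoning

  x*y≡0⇒y≡0 : ∀ {x y} → x ≢ 0F → x *F y ≡ 0F → y ≡ 0F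
  x*y≡0⇒y≡0 {x} x≢0 xy≡0 = *-cancelˡ x≢0 (trans xy≡0 (sym (zeroʳ x)))

  x*y≡0⇒x≡0⊎y≡0 : ∀ {x y} → x *F y ≡ 0F → x ≡ 0F ⊎ y ≡ 0F
  x*y≡0⇒x≡0⊎y≡0 {x} xy≡0 with x ≟F 0F
  ... | yes x≡0 = inj₁ x≡0
  ... | no x≢0  = inj₂ (x*y≡0⇒y≡0 x≢0 xy≡0)

  *-nonzero : ∀ {x y} → x ≢ 0F → y ≢ 0F → x *F y ≢ 0F
  *-nonzero x≢0 y≢0 xy≡0 = y≢0 (x*y≡0⇒y≡0 x≢0 xy≡0)

  x*x≡0⇒x≡0 : ∀ {x} → x *F x ≡ 0F → x ≡ 0F
  x*x≡0⇒x≡0 xx≡0 with x*y≡0⇒x≡0⊎y≡0 xx≡0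
  ... | inj₁ x≡0 = x≡0
  ... | inj₂ x≡0 = x≡0

  x−y≡0⇒x≡y : ∀ {x y} → x − y ≡ 0F → x ≡ y
  x−y≡0⇒x≡y = x∙y⁻¹≈ε⇒x≈y _ _

  x≡y⇒x−y≡0 : ∀ {x y} → x ≡ y → x − y ≡ 0F
  x≡y⇒x−y≡0 refl = -‿inverseʳ _

  -- In characteristic 2 the fibres of the Artin–Schreier map ℘ x = x² + x are the pairs
  -- {x, x + 1}, so |F| is even.
  module _ (1+1≡0 : 1F +F 1F ≡ 0F) where

    private
      ℘ : F → F
      ℘ x = x *F x +F x

      -x≡x : ∀ x → -F x ≡ x
      -x≡x x = sym (x−y≡0⇒x≡y (begin
        x − (-F x)        ≡⟨ solve 1 (λ x → x :- (:- x) := (con 1ℤ :+ con 1ℤ) :* x) refl x ⟩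
        (1F +F 1F) *F x   ≡⟨ cong (_*F x) 1+1≡0 ⟩
        0F *F x           ≡⟨ zeroˡ x ⟩
        0F                ∎))
        where open ≡-Reasoning

      ℘-fibre : ∀ {x z} → ℘ z ≡ ℘ x → z ≡ x ⊎ z ≡ x +F 1F
      ℘-fibre {x} {z} ℘z≡℘x with x*y≡0⇒x≡0⊎y≡0 (trans factor (x≡y⇒x−y≡0 ℘z≡℘x))
        where
        factor : (z − x) *F (z +F (x +F 1F)) ≡ ℘ z − ℘ x
        factor = solve 2 (λ z x → (z :- x) :* (z :+ (x :+ con 1ℤ)) := (z :* z :+ z) :- (x :* x :+ x)) refl z x
      ... | inj₁ z−x≡0   = inj₁ (x−y≡0⇒x≡y z−x≡0)
      ... | inj₂ z+x+1≡0 = inj₂ (x−y≡0⇒x≡y (trans (cong (z +F_) (-x≡x (x +F 1F))) z+x+1≡0))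

      ℘-x+1 : ∀ x → ℘ (x +F 1F) ≡ ℘ x
      ℘-x+1 x = begin
        ℘ (x +F 1F)                      ≡⟨ solve 1 (λ x → ((x :+ con 1ℤ) :* (x :+ con 1ℤ)) :+ (x :+ con 1ℤ)
                                                  := (x :* x :+ x) :+ (con 1ℤ :+ con 1ℤ) :* (x :+ con 1ℤ)) refl x ⟩
        ℘ x +F (1F +F 1F) *F (x +F 1F)   ≡⟨ cong (λ t → ℘ x +F t *F (x +F 1F)) 1+1≡0 ⟩
        ℘ x +F 0F *F (x +F 1F)           ≡⟨ cong (℘ x +F_) (zeroˡ _) ⟩
        ℘ x +F 0F                        ≡⟨ +-identityʳ _ ⟩
        ℘ x                              ∎
        where open ≡-Reasoning

      x≢x+1 : ∀ x → x ≢ x +F 1F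
      x≢x+1 x x≡x+1 = 1≢0 (begin
        1F              ≡⟨ solve 1 (λ x → con 1ℤ := (x :+ con 1ℤ) :- x) refl x ⟩
        (x +F 1F) − x   ≡⟨ cong (_− x) x≡x+1 ⟨
        x − x           ≡⟨ -‿inverseʳ x ⟩
        0F              ∎)
        where open ≡-Reasoning

      fibre-℘≡2 : ∀ {x₀ y} → ℘ x₀ ≡ y → fibre _≟F_ ℘ y elems ≡ 2
      fibre-℘≡2 {x₀} {y} ℘x₀≡y =
        Unique-⊆-⊇⇒length≡ (filterB-Unique _ unique) ((x≢x+1 x₀ ∷ []) ∷ [] ∷ []) ⊆pair pair⊆
        where
        ⊆pair : filterB (λ x → does (℘ x ≟F y)) elems ⊆ x₀ ∷ x₀ +F 1F ∷ []
        ⊆pair z∈ with ℘-fibre (trans (T-does⁻ (_ ≟F y) (proj₂ (∈-filterB⁻ _ elems z∈))) (sym ℘x₀≡y))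
        ... | inj₁ z≡x₀   = here z≡x₀
        ... | inj₂ z≡x₀+1 = there (here z≡x₀+1)
        pair⊆ : x₀ ∷ x₀ +F 1F ∷ [] ⊆ filterB (λ x → does (℘ x ≟F y)) elems
        pair⊆ (here refl) = ∈-filterB⁺ _ (complete _) (T-does⁺ (_ ≟F y) ℘x₀≡y)
        pair⊆ (there (here refl)) =
          ∈-filterB⁺ _ (complete _) (T-does⁺ (_ ≟F y) (trans (℘-x+1 x₀) ℘x₀≡y))

      2∣fibre-℘ : ∀ y → 2 ∣ fibre _≟F_ ℘ y elems
      2∣fibre-℘ y with countB≡0⊎∃ (λ x → does (℘ x ≟F y)) elems
      ... | inj₁ empty = subst (2 ∣_) (sym empty) (2 ∣0)
      ... | inj₂ (x₀ , _ , hit) = subst (2 ∣_) (sym (fibre-℘≡2 (T-does⁻ (℘ x₀ ≟F y) hit))) (∣-refl {2})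

    2∣order : 2 ∣ order
    2∣order = even-fibres⇒even-length _≟F_ ℘ elems unique (λ _ → complete _) 2∣fibre-℘

  odd⇒1+1≢0 : order % 2 ≡ 1 → 1F +F 1F ≢ 0F
  odd⇒1+1≢0 odd 1+1≡0 = ℕ.1+n≢0 (trans (sym odd) (n∣m⇒m%n≡0 order 2 (2∣order 1+1≡0)))

  coord₀ coord₁ coord₂ : V → F
  coord₀ (a , _ , _) = a
  coord₁ (_ , b , _) = b
  coord₂ (_ , _ , c) = c

  ≡-triple : ∀ {a b c a′ b′ c′ : F} → a ≡ a′ → b ≡ b′ → c ≡ c′ → (a , b , c) ≡ (a′ , b′ , c′)
  ≡-triple refl refl refl = refl

  invF-1 : invF 1F ≡ 1F
  invF-1 = trans (sym (*-idˡ (invF 1F))) (*-invʳ 1F 1≢0)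

  scale-scale : ∀ k k′ v → scale k (scale k′ v) ≡ scale (k *F k′) v
  scale-scale k k′ (a , b , c) = ≡-triple (sym (*-assoc _ _ _)) (sym (*-assoc _ _ _)) (sym (*-assoc _ _ _))

  scale-1 : ∀ v → scale 1F v ≡ v
  scale-1 (a , b , c) = ≡-triple (*-idˡ a) (*-idˡ b) (*-idˡ c)

  infix 4 _∝_

  _∝_ : V → V → Set
  u ∝ v = ∃[ k ] k ≢ 0F × u ≡ scale k v

  ∝-sym : ∀ {u v} → u ∝ v → v ∝ u
  ∝-sym {u} {v} (k , k≢0 , u≡kv) = invF k , invF-nonzero k≢0 , (begin
    v                         ≡⟨ scale-1 v ⟨
    scale 1F v                ≡⟨ cong (λ t → scale t v) (*-invˡ k≢0) ⟨
    scale (invF k *F k) v     ≡⟨ scale-scale _ _ v ⟨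
    scale (invF k) (scale k v) ≡⟨ cong (scale (invF k)) u≡kv ⟨
    scale (invF k) u          ∎)
    where open ≡-Reasoning

  ∝-trans : ∀ {u v w} → u ∝ v → v ∝ w → u ∝ w
  ∝-trans {w = w} (k , k≢0 , u≡kv) (k′ , k′≢0 , v≡k′w) =
    k *F k′ , *-nonzero k≢0 k′≢0 , trans u≡kv (trans (cong (scale k) v≡k′w) (scale-scale k k′ w))

  normalize-∝ : ∀ v → v ≢ zeroV → normalize v ∝ v
  normalize-∝ (a , b , c) v≢0 with a ≟F 0F
  ... | no a≢0 = invF a , invF-nonzero a≢0 , refl
  ... | yes a≡0 with b ≟F 0F
  ...   | no b≢0 = invF b , invF-nonzero b≢0 , refl
  ...   | yes b≡0 with c ≟F 0F
  ...     | no c≢0  = invF c , invF-nonzero c≢0 , refl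
  ...     | yes c≡0 = ⊥-elim (v≢0 (≡-triple a≡0 b≡0 c≡0))

  data Canonical : V → Set where
    affine : ∀ b c → Canonical (1F , b , c)
    ideal  : ∀ c → Canonical (0F , 1F , c)
    ideal∞ : Canonical (0F , 0F , 1F)

  canonical-normalize : ∀ v → v ≢ zeroV → Canonical (normalize v)
  canonical-normalize (a , b , c) v≢0 with a ≟F 0F
  ... | no a≢0 = subst Canonical (≡-triple (sym (*-invˡ a≢0)) refl refl) (affine _ _)
  ... | yes refl with b ≟F 0F
  ...   | no b≢0 = subst Canonical (≡-triple (sym (zeroʳ _)) (sym (*-invˡ b≢0)) refl) (ideal _)
  ...   | yes refl with c ≟F 0F
  ...     | no c≢0 = subst Canonical (≡-triple (sym (zeroʳ _)) (sym (zeroʳ _)) (sym (*-invˡ c≢0))) ideal∞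
  ...     | yes refl = ⊥-elim (v≢0 refl)

  canonical≢0 : ∀ {v} → Canonical v → v ≢ zeroV
  canonical≢0 (affine b c) v≡0 = 1≢0 (cong coord₀ v≡0)
  canonical≢0 (ideal c)    v≡0 = 1≢0 (cong coord₁ v≡0)
  canonical≢0 ideal∞       v≡0 = 1≢0 (cong coord₂ v≡0)

  normalize-canonical : ∀ {v} → Canonical v → normalize v ≡ v
  normalize-canonical {v} c = begin
    normalize v           ≡⟨ normalize-1 c ⟩
    scale (invF 1F) v     ≡⟨ cong (λ k → scale k v) invF-1 ⟩
    scale 1F v            ≡⟨ scale-1 v ⟩
    v                     ∎
    where
    open ≡-Reasoning
    normalize-1 : ∀ {v} → Canonical v → normalize v ≡ scale (invF 1F) v
    normalize-1 (affine b c) with 1F ≟F 0F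
    ... | yes 1≡0 = ⊥-elim (1≢0 1≡0)
    ... | no _    = refl
    normalize-1 (ideal c) with 0F ≟F 0F | 1F ≟F 0F
    ... | no 0≢0 | _      = ⊥-elim (0≢0 refl)
    ... | yes _ | yes 1≡0 = ⊥-elim (1≢0 1≡0)
    ... | yes _ | no _    = refl
    normalize-1 ideal∞ with 0F ≟F 0F | 1F ≟F 0F
    ... | no 0≢0 | _      = ⊥-elim (0≢0 refl)
    ... | yes _ | yes 1≡0 = ⊥-elim (1≢0 1≡0)
    ... | yes _ | no _    = refl

  -- Comparing the first nonzero coordinates forces the scalar to be 1.
  ∝-canonical⇒≡ : ∀ {u v} → Canonical u → Canonical v → u ∝ v → u ≡ v
  ∝-canonical⇒≡ cu cv (k , _ , u≡kv) = go cu cv u≡kv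
    where
    k≡1 : 1F ≡ k *F 1F → k ≡ 1F
    k≡1 e = trans (sym (*-identityʳ k)) (sym e)
    k≡1⇒k·x≡x : k ≡ 1F → ∀ x → k *F x ≡ x
    k≡1⇒k·x≡x refl = *-idˡ
    k·x≡0 : 0F ≡ k *F 1F → ∀ x → k *F x ≡ 0F
    k·x≡0 e x = trans (cong (_*F x) (trans (sym (*-identityʳ k)) (sym e))) (zeroˡ x)
    1≢k·0 : 1F ≢ k *F 0F
    1≢k·0 e = 1≢0 (trans e (zeroʳ k))
    go : ∀ {u v} → Canonical u → Canonical v → u ≡ scale k v → u ≡ v
    go (affine _ _) (affine b c) e = let k≡1 = k≡1 (cong coord₀ e) in
      ≡-triple refl (trans (cong coord₁ e) (k≡1⇒k·x≡x k≡1 b)) (trans (cong coord₂ e) (k≡1⇒k·x≡x k≡1 c))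
    go (ideal _) (ideal c) e = ≡-triple refl refl (trans (cong coord₂ e) (k≡1⇒k·x≡x (k≡1 (cong coord₁ e)) c))
    go ideal∞ ideal∞ _ = refl
    go (affine _ _) (ideal _) e = ⊥-elim (1≢k·0 (cong coord₀ e))
    go (affine _ _) ideal∞ e = ⊥-elim (1≢k·0 (cong coord₀ e))
    go (ideal _) ideal∞ e = ⊥-elim (1≢k·0 (cong coord₁ e))
    go (ideal _) (affine b _) e = ⊥-elim (1≢0 (trans (cong coord₁ e) (k·x≡0 (cong coord₀ e) b)))
    go ideal∞ (affine _ c) e = ⊥-elim (1≢0 (trans (cong coord₂ e) (k·x≡0 (cong coord₀ e) c)))
    go ideal∞ (ideal c) e = ⊥-elim (1≢0 (trans (cong coord₂ e) (k·x≡0 (cong coord₁ e) c)))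

  allV-complete : ∀ v → v ∈ allV
  allV-complete (a , b , c) =
    ∈-concatMap⁺ _ (∈-concatMap⁺ _ (∈-map⁺ (λ c → a , b , c) (complete c)) (complete b)) (complete a)

  allV-Unique : Unique allV
  allV-Unique = concatMap-Unique _ unique
    (λ a → concatMap-Unique _ unique (λ b → Unique.map⁺ (cong coord₂) unique)
             (λ v∈ v∈′ → trans (sym (second v∈)) (second v∈′)))
    (λ v∈ v∈′ → trans (sym (first v∈)) (first v∈′))
    where
    second : ∀ {a b v} → v ∈ map (λ c → a , b , c) elems → coord₁ v ≡ b
    second v∈ = let _ , _ , v≡ = ∈-map⁻ _ v∈ in cong coord₁ v≡
    first : ∀ {a v} → v ∈ concatMap (λ b → map (λ c → a , b , c) elems) elems → coord₀ v ≡ a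
    first v∈ = let _ , _ , v∈′ = ∈-concatMap⁻ _ elems v∈ ; _ , _ , v≡ = ∈-map⁻ _ v∈′ in cong coord₀ v≡

  points-Unique : Unique points
  points-Unique = filterB-Unique _ allV-Unique

  ∈points⁺ : ∀ {v} → Canonical v → v ∈ points
  ∈points⁺ {v} c = ∈-filterB⁺ _ (allV-complete v)
    (from T-∧ (T-not-does⁺ (v ≟V zeroV) (canonical≢0 c) ,
               T-does⁺ (normalize v ≟V v) (normalize-canonical c)))

  ∈points⁻ : ∀ {v} → v ∈ points → Canonical v
  ∈points⁻ {v} v∈ =
    let v≢0 , nv≡v = to T-∧ (proj₂ (∈-filterB⁻ _ allV v∈)) in
    subst Canonical (T-does⁻ (normalize v ≟V v) nv≡v)
      (canonical-normalize v (T-not-does⁻ (v ≟V zeroV) v≢0))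

  normalize∈points : ∀ {v} → v ≢ zeroV → normalize v ∈ points
  normalize∈points {v} v≢0 = ∈points⁺ (canonical-normalize v v≢0)

  point≢0 : ∀ {v} → v ∈ points → v ≢ zeroV
  point≢0 v∈ = canonical≢0 (∈points⁻ v∈)

  ∝-points⇒≡ : ∀ {u v} → u ∈ points → v ∈ points → u ∝ v → u ≡ v
  ∝-points⇒≡ u∈ v∈ = ∝-canonical⇒≡ (∈points⁻ u∈) (∈points⁻ v∈)

  Incident : V → V → Set
  Incident l p = dotV l p ≡ 0F

  dot-scaleʳ : ∀ l k v → dotV l (scale k v) ≡ k *F dotV l v
  dot-scaleʳ (a , b , c) k (x , y , z) =
    solve 7 (λ a b c k x y z → a :* (k :* x) :+ (b :* (k :* y) :+ c :* (k :* z))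
                               := k :* (a :* x :+ (b :* y :+ c :* z))) refl a b c k x y z

  dot-scaleˡ : ∀ l k v → dotV (scale k l) v ≡ k *F dotV l v
  dot-scaleˡ (a , b , c) k (x , y , z) =
    solve 7 (λ a b c k x y z → (k :* a) :* x :+ ((k :* b) :* y :+ (k :* c) :* z)
                               := k :* (a :* x :+ (b :* y :+ c :* z))) refl a b c k x y z

  incident-∝ʳ : ∀ {l u v} → u ∝ v → Incident l v → Incident l u
  incident-∝ʳ {l} {u} {v} (k , _ , u≡kv) lv≡0 = begin
    dotV l u             ≡⟨ cong (dotV l) u≡kv ⟩
    dotV l (scale k v)   ≡⟨ dot-scaleʳ l k v ⟩
    k *F dotV l v        ≡⟨ cong (k *F_) lv≡0 ⟩
    k *F 0F              ≡⟨ zeroʳ k ⟩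
    0F                   ∎
    where open ≡-Reasoning

  incident-∝ˡ : ∀ {l l′ v} → l ∝ l′ → Incident l′ v → Incident l v
  incident-∝ˡ {l} {l′} {v} (k , _ , l≡kl′) l′v≡0 = begin
    dotV l v             ≡⟨ cong (λ m → dotV m v) l≡kl′ ⟩
    dotV (scale k l′) v  ≡⟨ dot-scaleˡ l′ k v ⟩
    k *F dotV l′ v       ≡⟨ cong (k *F_) l′v≡0 ⟩
    k *F 0F              ≡⟨ zeroʳ k ⟩
    0F                   ∎
    where open ≡-Reasoning

  data ConicPoint : V → Set where
    conic  : ∀ t → ConicPoint (1F , t , t *F t)
    conic∞ : ConicPoint (0F , 0F , 1F)

  conic∈points : ∀ {P} → ConicPoint P → P ∈ points
  conic∈points (conic t) = ∈points⁺ (affine t (t *F t))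
  conic∈points conic∞    = ∈points⁺ ideal∞

  T-onConic : ∀ {P} → ConicPoint P → T (onConic P)
  T-onConic (conic t) = T-does⁺ ((1F *F (t *F t)) ≟F (t *F t)) (*-idˡ _)
  T-onConic conic∞    = T-does⁺ ((0F *F 1F) ≟F (0F *F 0F)) (trans (zeroˡ 1F) (sym (zeroˡ 0F)))

  onConic⇒ConicPoint : ∀ {v} → v ∈ points → T (onConic v) → ConicPoint v
  onConic⇒ConicPoint {v} v∈ on = go (∈points⁻ v∈) (T-does⁻ (_ ≟F _) on)
    where
    go : ∀ {v} → Canonical v → coord₀ v *F coord₂ v ≡ coord₁ v *F coord₁ v → ConicPoint v
    go (affine b c) 1c≡bb =
      subst (λ x → ConicPoint (1F , b , x)) (sym (trans (sym (*-idˡ c)) 1c≡bb)) (conic b)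
    go (ideal c)    0c≡11 = ⊥-elim (0≢1 (trans (sym (zeroˡ c)) (trans 0c≡11 (*-idˡ 1F))))
    go ideal∞       _     = conic∞

  polar : V → V
  polar (a , b , c) = c , -F (b +F b) , a

  polar-conic∞ : ∀ x y z → dotV (polar (0F , 0F , 1F)) (x , y , z) ≡ x
  polar-conic∞ =
    solve 3 (λ x y z → con 1ℤ :* x :+ ((:- (con 0ℤ :+ con 0ℤ)) :* y :+ con 0ℤ :* z) := x) refl

  polar-conic : ∀ t x y z → dotV (polar (1F , t , t *F t)) (x , y , z) ≡ (t *F t) *F x − (t +F t) *F y +F z
  polar-conic = solve 4 (λ t x y z → (t :* t) :* x :+ ((:- (t :+ t)) :* y :+ con 1ℤ :* z)
                                     := (t :* t) :* x :- (t :+ t) :* y :+ z) refl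

  polar-self : ∀ {P} → ConicPoint P → Incident (polar P) P
  polar-self (conic t) = trans (polar-conic t 1F t (t *F t))
    (solve 1 (λ t → (t :* t) :* con 1ℤ :- (t :+ t) :* t :+ t :* t := con 0ℤ) refl t)
  polar-self conic∞ = polar-conic∞ 0F 0F 1F

  polar-meets-conic-once : ∀ {P Q} → ConicPoint P → ConicPoint Q → Incident (polar P) Q → Q ≡ P
  polar-meets-conic-once (conic t) (conic s) PQ =
    cong (λ u → 1F , u , u *F u) (sym (x−y≡0⇒x≡y (x*x≡0⇒x≡0 (begin
      (t − s) *F (t − s)
        ≡⟨ solve 2 (λ t s → (t :- s) :* (t :- s) := (t :* t) :* con 1ℤ :- (t :+ t) :* s :+ s :* s) refl t s ⟩
      (t *F t) *F 1F − (t +F t) *F s +F s *F s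
        ≡⟨ polar-conic t 1F s (s *F s) ⟨
      dotV (polar (1F , t , t *F t)) (1F , s , s *F s)
        ≡⟨ PQ ⟩
      0F ∎))))
    where open ≡-Reasoning
  polar-meets-conic-once (conic t) conic∞ PQ = ⊥-elim (1≢0 (begin
    1F
      ≡⟨ solve 1 (λ t → con 1ℤ := (t :* t) :* con 0ℤ :- (t :+ t) :* con 0ℤ :+ con 1ℤ) refl t ⟩
    (t *F t) *F 0F − (t +F t) *F 0F +F 1F
      ≡⟨ polar-conic t 0F 0F 1F ⟨
    dotV (polar (1F , t , t *F t)) (0F , 0F , 1F)
      ≡⟨ PQ ⟩
    0F ∎))
    where open ≡-Reasoning
  polar-meets-conic-once conic∞ (conic s) PQ = ⊥-elim (1≢0 (trans (sym (polar-conic∞ 1F s (s *F s))) PQ))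
  polar-meets-conic-once conic∞ conic∞ _ = refl

  dot-conic∞ : ∀ a b c → dotV (a , b , c) (0F , 0F , 1F) ≡ c
  dot-conic∞ = solve 3 (λ a b c → a :* con 0ℤ :+ (b :* con 0ℤ :+ c :* con 1ℤ) := c) refl

  MeetsConicOnlyAt : V → V → Set
  MeetsConicOnlyAt l Q = ∀ {z} → ConicPoint z → Incident l z → z ≡ Q

  -- In both cases below, if l were not the polar, the other root of the quadratic that l
  -- cuts out on the conic would give a second intersection point.
  tangent-is-polar∞ : ∀ {l} → l ≢ zeroV → Incident l (0F , 0F , 1F) → MeetsConicOnlyAt l (0F , 0F , 1F) →
                      l ∝ polar (0F , 0F , 1F)
  tangent-is-polar∞ {a , b , c} l≢0 lQ only with b ≟F 0F
  ... | no b≢0 = ⊥-elim (1≢0 (cong coord₀ (only (conic s) ls)))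
    where
    u s : F
    u = invF b
    s = -F (a *F u)
    c≡0 : c ≡ 0F
    c≡0 = trans (sym (dot-conic∞ a b c)) lQ
    ls : Incident (a , b , c) (1F , s , s *F s)
    ls = begin
      a *F 1F +F (b *F s +F c *F (s *F s))
        ≡⟨ solve 4 (λ a b c u → a :* con 1ℤ :+ (b :* (:- (a :* u)) :+ c :* ((:- (a :* u)) :* (:- (a :* u))))
                                := a :* (con 1ℤ :- b :* u) :+ c :* ((a :* u) :* (a :* u))) refl a b c u ⟩
      a *F (1F − b *F u) +F c *F ((a *F u) *F (a *F u))
        ≡⟨ cong₂ (λ x y → a *F (1F − x) +F y *F ((a *F u) *F (a *F u))) (*-invʳ b b≢0) c≡0 ⟩
      a *F (1F − 1F) +F 0F *F ((a *F u) *F (a *F u))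
        ≡⟨ solve 2 (λ a w → a :* (con 1ℤ :- con 1ℤ) :+ con 0ℤ :* w := con 0ℤ) refl a _ ⟩
      0F ∎
      where open ≡-Reasoning
  ... | yes b≡0 with a ≟F 0F
  ...   | yes a≡0 = ⊥-elim (l≢0 (≡-triple a≡0 b≡0 (trans (sym (dot-conic∞ a b c)) lQ)))
  ...   | no a≢0  = a , a≢0 , ≡-triple (sym (*-identityʳ a))
                                      (trans b≡0 (sym (solve 1 (λ a → a :* (:- (con 0ℤ :+ con 0ℤ)) := con 0ℤ) refl a)))
                                      (trans (trans (sym (dot-conic∞ a b c)) lQ) (sym (zeroʳ a)))
  tangent-is-polar-affine : ∀ {l t} → Incident l (1F , t , t *F t) → MeetsConicOnlyAt l (1F , t , t *F t) →
                            l ∝ polar (1F , t , t *F t)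
  tangent-is-polar-affine {a , b , c} {t} lQ only with c ≟F 0F
  ... | yes c≡0 = ⊥-elim (0≢1 (cong coord₀ (only conic∞ (trans (dot-conic∞ a b c) c≡0))))
  ... | no c≢0  = c , c≢0 , ≡-triple a≡ b≡ (sym (*-identityʳ c))
    where
    open ≡-Reasoning
    u s : F
    u = invF c
    cu≡1 : c *F u ≡ 1F
    cu≡1 = *-invʳ c c≢0
    s = -F (b *F u) − t
    lt : a +F (b *F t +F c *F (t *F t)) ≡ 0F
    lt = trans (cong (_+F (b *F t +F c *F (t *F t))) (sym (*-identityʳ a))) lQ
    ls : Incident (a , b , c) (1F , s , s *F s)
    ls = begin
      a *F 1F +F (b *F s +F c *F (s *F s))
        ≡⟨ solve 5 (λ a b c t u →
             a :* con 1ℤ :+ (b :* ((:- (b :* u)) :- t) :+ c :* (((:- (b :* u)) :- t) :* ((:- (b :* u)) :- t)))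
             := (a :+ (b :* t :+ c :* (t :* t))) :+ (con 1ℤ :- c :* u) :* (b :* ((:- (b :* u)) :- t) :- b :* t))
             refl a b c t u ⟩
      (a +F (b *F t +F c *F (t *F t))) +F (1F − c *F u) *F (b *F s − b *F t)
        ≡⟨ cong₂ (λ x y → x +F (1F − y) *F (b *F s − b *F t)) lt cu≡1 ⟩
      0F +F (1F − 1F) *F (b *F s − b *F t)
        ≡⟨ solve 1 (λ w → con 0ℤ :+ (con 1ℤ :- con 1ℤ) :* w := con 0ℤ) refl _ ⟩
      0F ∎
    s≡t : s ≡ t
    s≡t = cong coord₁ (only (conic s) ls)
    b≡ : b ≡ c *F (-F (t +F t))
    b≡ = x−y≡0⇒x≡y (begin
      b − c *F (-F (t +F t))
        ≡⟨ solve 4 (λ b c t u → b :- c :* (:- (t :+ t))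
                                := b :* (con 1ℤ :- c :* u) :+ (:- c) :* (((:- (b :* u)) :- t) :- t)) refl b c t u ⟩
      b *F (1F − c *F u) +F (-F c) *F (s − t)
        ≡⟨ cong₂ (λ x y → b *F (1F − x) +F (-F c) *F (y − t)) cu≡1 s≡t ⟩
      b *F (1F − 1F) +F (-F c) *F (t − t)
        ≡⟨ solve 3 (λ b c t → b :* (con 1ℤ :- con 1ℤ) :+ (:- c) :* (t :- t) := con 0ℤ) refl b c t ⟩
      0F ∎)
    a≡ : a ≡ c *F (t *F t)
    a≡ = x−y≡0⇒x≡y (begin
      a − c *F (t *F t)
        ≡⟨ solve 4 (λ a b c t → a :- c :* (t :* t)
                                := (a :+ (b :* t :+ c :* (t :* t))) :+ (:- t) :* (b :- c :* (:- (t :+ t)))) refl a b c t ⟩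
      (a +F (b *F t +F c *F (t *F t))) +F (-F t) *F (b − c *F (-F (t +F t)))
        ≡⟨ cong₂ (λ x y → x +F (-F t) *F y) lt (x≡y⇒x−y≡0 b≡) ⟩
      0F +F (-F t) *F 0F
        ≡⟨ solve 1 (λ t → con 0ℤ :+ (:- t) :* con 0ℤ := con 0ℤ) refl t ⟩
      0F ∎)

  tangent-is-polar : ∀ {l Q} → l ≢ zeroV → ConicPoint Q → Incident l Q → MeetsConicOnlyAt l Q → l ∝ polar Q
  tangent-is-polar l≢0 conic∞    = tangent-is-polar∞ l≢0
  tangent-is-polar _   (conic t) = tangent-is-polar-affine

  tangentLine : V → V
  tangentLine Q = normalize (polar Q)

  polar≢0 : ∀ {P} → ConicPoint P → polar P ≢ zeroV
  polar≢0 (conic t) e = 1≢0 (cong coord₂ e)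
  polar≢0 conic∞    e = 1≢0 (cong coord₀ e)

  tangentLine∈points : ∀ {Q} → ConicPoint Q → tangentLine Q ∈ points
  tangentLine∈points Q = normalize∈points (polar≢0 Q)

  tangentLine-∝ : ∀ {Q} → ConicPoint Q → tangentLine Q ∝ polar Q
  tangentLine-∝ {Q} cQ = normalize-∝ (polar Q) (polar≢0 cQ)

  T-incident⁺ : ∀ {l p} → Incident l p → T (incident l p)
  T-incident⁺ {l} {p} = T-does⁺ (dotV l p ≟F 0F)

  T-incident⁻ : ∀ {l p} → T (incident l p) → Incident l p
  T-incident⁻ {l} {p} = T-does⁻ (dotV l p ≟F 0F)

  isTangent⇒∝polar : ∀ {l} → l ∈ points → T (isTangent l) → ∃[ Q ] ConicPoint Q × l ∝ polar Q
  isTangent⇒∝polar {l} l∈ tangent =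
    let Q , Q∈ , onQ , only = countB≡1⁻ _ points (ℕ.≡ᵇ⇒≡ _ 1 tangent)
        conicQ , lQ = to T-∧ onQ
        cQ = onConic⇒ConicPoint Q∈ conicQ
    in Q , cQ , tangent-is-polar (point≢0 l∈) cQ (T-incident⁻ lQ)
                  (λ cz lz → only (conic∈points cz) (from T-∧ (T-onConic cz , T-incident⁺ lz)))

  isTangent-tangentLine : ∀ {Q} → ConicPoint Q → T (isTangent (tangentLine Q))
  isTangent-tangentLine {Q} cQ = ℕ.≡⇒≡ᵇ _ 1 (countB≡1 _ points-Unique (conic∈points cQ)
    (from T-∧ (T-onConic cQ , T-incident⁺ (incident-∝ˡ (tangentLine-∝ cQ) (polar-self cQ))))
    (λ z∈ on-z → let conic-z , lz = to T-∧ on-z in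
       polar-meets-conic-once cQ (onConic⇒ConicPoint z∈ conic-z)
         (incident-∝ˡ (∝-sym (tangentLine-∝ cQ)) (T-incident⁻ lz))))

  data External (x : V) : Set where
    external : ∀ {P P′} → ConicPoint P → ConicPoint P′ → P ≢ P′ →
               Incident (polar P) x → Incident (polar P′) x → External x

  isExternal⁺ : ∀ {x} → External x → T (isExternal x)
  isExternal⁺ {x} (external {P} {P′} cP cP′ P≢P′ Px P′x) = ℕ.≤⇒≤ᵇ (2≤countB _ points
    (tangentLine∈points cP) (tangentLine∈points cP′) distinct
    (from T-∧ (isTangent-tangentLine cP , T-incident⁺ (incident-∝ˡ (tangentLine-∝ cP) Px)))
    (from T-∧ (isTangent-tangentLine cP′ , T-incident⁺ (incident-∝ˡ (tangentLine-∝ cP′) P′x))))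
    where
    distinct : tangentLine P ≢ tangentLine P′
    distinct tP≡tP′ = P≢P′ (polar-meets-conic-once cP′ cP
      (incident-∝ˡ (∝-sym (tangentLine-∝ cP′))
        (subst (λ l → Incident l P) tP≡tP′ (incident-∝ˡ (tangentLine-∝ cP) (polar-self cP)))))

  isExternal⁻ : ∀ {x} → T (isExternal x) → External x
  isExternal⁻ ext =
    let l , l′ , l∈ , l′∈ , l≢l′ , tl , tl′ = 2≤countB⁻ _ points points-Unique (ℕ.≤ᵇ⇒≤ 2 _ ext)
        tangent , lx = to T-∧ tl
        tangent′ , l′x = to T-∧ tl′
        Q , cQ , l∝Q = isTangent⇒∝polar l∈ tangent
        Q′ , cQ′ , l′∝Q′ = isTangent⇒∝polar l′∈ tangent′
    in external cQ cQ′
         (λ Q≡Q′ → l≢l′ (∝-points⇒≡ l∈ l′∈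
                            (∝-trans l∝Q (subst (λ R → polar R ∝ l′) (sym Q≡Q′) (∝-sym l′∝Q′)))))
         (incident-∝ˡ (∝-sym l∝Q) (T-incident⁻ lx)) (incident-∝ˡ (∝-sym l′∝Q′) (T-incident⁻ l′x))

  ∈Ω⁺ : ∀ {x} → x ∈ points → External x → x ∈ Ω
  ∈Ω⁺ x∈ ext = ∈-filterB⁺ isExternal x∈ (isExternal⁺ ext)

  ∈Ω⁻ : ∀ {x} → x ∈ Ω → x ∈ points × External x
  ∈Ω⁻ x∈ = let x∈points , ext = ∈-filterB⁻ isExternal points x∈ in x∈points , isExternal⁻ ext

  Ω-Unique : Unique Ω
  Ω-Unique = filterB-Unique isExternal points-Unique

  NonzeroSquare : F → Set
  NonzeroSquare d = d ≢ 0F × ∃[ r ] r *F r ≡ d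

  isNonzeroSquare : F → Bool
  isNonzeroSquare d = not (d ==F 0F) ∧ any (λ r → (r *F r) ==F d) elems

  T-isNonzeroSquare⁺ : ∀ {d} → NonzeroSquare d → T (isNonzeroSquare d)
  T-isNonzeroSquare⁺ {d} (d≢0 , r , rr≡d) =
    from T-∧ (T-not-does⁺ (d ≟F 0F) d≢0 , any-intro _ (complete r) (T-does⁺ ((r *F r) ≟F d) rr≡d))

  T-isNonzeroSquare⁻ : ∀ {d} → T (isNonzeroSquare d) → NonzeroSquare d
  T-isNonzeroSquare⁻ {d} sq =
    let d≢0 , root = to T-∧ sq ; r , _ , rr≡d = any-elim _ elems root in
    T-not-does⁻ (d ≟F 0F) d≢0 , r , T-does⁻ ((r *F r) ≟F d) rr≡d

  polar-conic-affine : ∀ t b c →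
    dotV (polar (1F , t , t *F t)) (1F , b , c) ≡ (t − b) *F (t − b) − (b *F b − c)
  polar-conic-affine t b c = trans (polar-conic t 1F b c)
    (solve 3 (λ t b c → (t :* t) :* con 1ℤ :- (t :+ t) :* b :+ c := (t :- b) :* (t :- b) :- (b :* b :- c))
             refl t b c)

  incident-polar-conic⁻ : ∀ {t b c} → Incident (polar (1F , t , t *F t)) (1F , b , c) →
                          (t − b) *F (t − b) ≡ b *F b − c
  incident-polar-conic⁻ {t} {b} {c} Pv = x−y≡0⇒x≡y (trans (sym (polar-conic-affine t b c)) Pv)

  incident-polar-conic⁺ : ∀ {t b c} → (t − b) *F (t − b) ≡ b *F b − c →
                          Incident (polar (1F , t , t *F t)) (1F , b , c)
  incident-polar-conic⁺ {t} {b} {c} sq = trans (polar-conic-affine t b c) (x≡y⇒x−y≡0 sq)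

  external-affine⁻ : ∀ {b c} → External (1F , b , c) → NonzeroSquare (b *F b − c)
  external-affine⁻ {b} {c} (external (conic t) (conic t′) P≢P′ Pv P′v) =
    d≢0 , t − b , incident-polar-conic⁻ Pv
    where
    d≢0 : b *F b − c ≢ 0F
    d≢0 d≡0 = P≢P′ (cong (λ u → 1F , u , u *F u) (trans (t≡b t Pv) (sym (t≡b t′ P′v))))
      where
      t≡b : ∀ t → Incident (polar (1F , t , t *F t)) (1F , b , c) → t ≡ b
      t≡b t Pv = x−y≡0⇒x≡y (x*x≡0⇒x≡0 (trans (incident-polar-conic⁻ Pv) d≡0))
  external-affine⁻ {b} {c} (external conic∞ _ _ Pv _) = ⊥-elim (1≢0 (trans (sym (polar-conic∞ 1F b c)) Pv))
  external-affine⁻ {b} {c} (external (conic _) conic∞ _ _ P′v) =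
    ⊥-elim (1≢0 (trans (sym (polar-conic∞ 1F b c)) P′v))

  ¬external-ideal∞ : ¬ External (0F , 0F , 1F)
  ¬external-ideal∞ (external cP cP′ P≢P′ Pv P′v) =
    P≢P′ (trans (sym (polar-meets-conic-once cP conic∞ Pv)) (polar-meets-conic-once cP′ conic∞ P′v))

  cofactor : Mat → Mat
  cofactor ((a , b , c) , (d , e , f) , (g , h , i)) =
    (e *F i − f *F h , -F (d *F i − f *F g) , d *F h − e *F g) ,
    (-F (b *F i − c *F h) , a *F i − c *F g , -F (a *F h − b *F g)) ,
    (b *F f − c *F e , -F (a *F f − c *F d) , a *F e − b *F d)

  -- adj(M) M = det(M) I, written as a bilinear identity.
  cofactor-dot : ∀ M u v → dotV (mulMV (cofactor M) u) (mulMV M v) ≡ det M *F dotV u v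
  cofactor-dot ((a , b , c) , (d , e , f) , (g , h , i)) (p , q , r) (x , y , z) =
    solve 15 (λ a b c d e f g h i p q r x y z →
      ((e :* i :- f :* h) :* p :+ ((:- (d :* i :- f :* g)) :* q :+ (d :* h :- e :* g) :* r))
          :* (a :* x :+ (b :* y :+ c :* z))
      :+ (((:- (b :* i :- c :* h)) :* p :+ ((a :* i :- c :* g) :* q :+ (:- (a :* h :- b :* g)) :* r))
          :* (d :* x :+ (e :* y :+ f :* z))
      :+ ((b :* f :- c :* e) :* p :+ ((:- (a :* f :- c :* d)) :* q :+ (a :* e :- b :* d) :* r))
          :* (g :* x :+ (h :* y :+ i :* z)))
      := ((a :* (e :* i :- f :* h) :- b :* (d :* i :- f :* g)) :+ c :* (d :* h :- e :* g))
          :* (p :* x :+ (q :* y :+ r :* z)))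
      refl a b c d e f g h i p q r x y z

  dotV-comm : ∀ u v → dotV u v ≡ dotV v u
  dotV-comm (a , b , c) (x , y , z) =
    solve 6 (λ a b c x y z → a :* x :+ (b :* y :+ c :* z) := x :* a :+ (y :* b :+ z :* c)) refl a b c x y z

  dotV-zeroˡ : ∀ v → dotV zeroV v ≡ 0F
  dotV-zeroˡ (x , y , z) =
    solve 3 (λ x y z → con 0ℤ :* x :+ (con 0ℤ :* y :+ con 0ℤ :* z) := con 0ℤ) refl x y z

  dotV-basis : ∀ x y z → dotV (1F , 0F , 0F) (x , y , z) ≡ x × dotV (0F , 1F , 0F) (x , y , z) ≡ y
                                                        × dotV (0F , 0F , 1F) (x , y , z) ≡ z
  dotV-basis x y z =
    solve 3 (λ x y z → con 1ℤ :* x :+ (con 0ℤ :* y :+ con 0ℤ :* z) := x) refl x y z ,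
    solve 3 (λ x y z → con 0ℤ :* x :+ (con 1ℤ :* y :+ con 0ℤ :* z) := y) refl x y z ,
    solve 3 (λ x y z → con 0ℤ :* x :+ (con 0ℤ :* y :+ con 1ℤ :* z) := z) refl x y z

  dotV-ext : ∀ {u v} → (∀ e → dotV e u ≡ dotV e v) → u ≡ v
  dotV-ext {x , y , z} {x′ , y′ , z′} same =
    let e₀ , e₁ , e₂ = dotV-basis x y z ; e₀′ , e₁′ , e₂′ = dotV-basis x′ y′ z′ in
    ≡-triple (trans (sym e₀) (trans (same _) e₀′)) (trans (sym e₁) (trans (same _) e₁′))
             (trans (sym e₂) (trans (same _) e₂′))

  mulMV-scale : ∀ M k v → mulMV M (scale k v) ≡ scale k (mulMV M v)
  mulMV-scale (r₀ , r₁ , r₂) k v = ≡-triple (dot-scaleʳ r₀ k v) (dot-scaleʳ r₁ k v) (dot-scaleʳ r₂ k v)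

  module _ {M : Mat} (det≢0 : det M ≢ 0F) where

    mulMV-injective : ∀ {u v} → mulMV M u ≡ mulMV M v → u ≡ v
    mulMV-injective {u} {v} Mu≡Mv = dotV-ext λ e → *-cancelˡ det≢0 (begin
      det M *F dotV e u                        ≡⟨ cofactor-dot M e u ⟨
      dotV (mulMV (cofactor M) e) (mulMV M u)  ≡⟨ cong (dotV (mulMV (cofactor M) e)) Mu≡Mv ⟩
      dotV (mulMV (cofactor M) e) (mulMV M v)  ≡⟨ cofactor-dot M e v ⟩
      det M *F dotV e v                        ∎)
      where open ≡-Reasoning

    mulMV≢0 : ∀ {v} → v ≢ zeroV → mulMV M v ≢ zeroV
    mulMV≢0 {v} v≢0 Mv≡0 = v≢0 (mulMV-injective (trans Mv≡0 (sym (mulMV-zero M))))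
      where
      mulMV-zero : ∀ M → mulMV M zeroV ≡ zeroV
      mulMV-zero (r₀ , r₁ , r₂) = ≡-triple (trans (dotV-comm r₀ zeroV) (dotV-zeroˡ r₀))
        (trans (dotV-comm r₁ zeroV) (dotV-zeroˡ r₁)) (trans (dotV-comm r₂ zeroV) (dotV-zeroˡ r₂))

    cofactor≢0 : ∀ {l} → l ≢ zeroV → mulMV (cofactor M) l ≢ zeroV
    cofactor≢0 {l} l≢0 cof-l≡0 = l≢0 (dotV-ext λ e → *-cancelˡ det≢0 (begin
      det M *F dotV e l                          ≡⟨ cong (det M *F_) (dotV-comm e l) ⟩
      det M *F dotV l e                          ≡⟨ cofactor-dot M l e ⟨
      dotV (mulMV (cofactor M) l) (mulMV M e)    ≡⟨ cong (λ w → dotV w (mulMV M e)) cof-l≡0 ⟩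
      dotV zeroV (mulMV M e)                     ≡⟨ dotV-zeroˡ _ ⟩
      0F                                         ≡⟨ zeroʳ _ ⟨
      det M *F 0F                                ≡⟨ cong (det M *F_) (dotV-zeroˡ e) ⟨
      det M *F dotV zeroV e                      ≡⟨ cong (det M *F_) (dotV-comm zeroV e) ⟩
      det M *F dotV e zeroV                      ∎))
      where open ≡-Reasoning

  module _ (τ : FieldAut) where

    open FieldAut τ

    σ-0 : σ 0F ≡ 0F
    σ-0 = +-identityʳ-unique (σ 0F) (σ 0F) (trans (sym (σ-+ 0F 0F)) (cong σ (+-idˡ 0F)))

    σ≡0⇒≡0 : ∀ {x} → σ x ≡ 0F → x ≡ 0F
    σ≡0⇒≡0 {x} σx≡0 = σ-inj x 0F (trans σx≡0 (sym σ-0))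

    σV : V → V
    σV (a , b , c) = σ a , σ b , σ c

    σV-dot : ∀ u v → σ (dotV u v) ≡ dotV (σV u) (σV v)
    σV-dot (a , b , c) (x , y , z) =
      trans (σ-+ _ _) (cong₂ _+F_ (σ-* a x) (trans (σ-+ _ _) (cong₂ _+F_ (σ-* b y) (σ-* c z))))

    σV≢0 : ∀ {v} → v ≢ zeroV → σV v ≢ zeroV
    σV≢0 {a , b , c} v≢0 σv≡0 =
      v≢0 (≡-triple (σ≡0⇒≡0 (cong coord₀ σv≡0)) (σ≡0⇒≡0 (cong coord₁ σv≡0))
                                              (σ≡0⇒≡0 (cong coord₂ σv≡0)))

    σV-∝ : ∀ {u v k} → k ≢ 0F → σV u ≡ scale k (σV v) → u ∝ v
    σV-∝ {a , b , c} {x , y , z} {k} k≢0 σu≡kσv with σ-surj k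
    ... | k′ , refl = k′ , (λ k′≡0 → k≢0 (trans (cong σ k′≡0) σ-0)) ,
      ≡-triple (descend (cong coord₀ σu≡kσv)) (descend (cong coord₁ σu≡kσv)) (descend (cong coord₂ σu≡kσv))
      where
      descend : ∀ {s t} → σ s ≡ σ k′ *F σ t → s ≡ k′ *F t
      descend {s} {t} σs≡kσt = σ-inj _ _ (trans σs≡kσt (sym (σ-* k′ t)))

  module _ (g : GElt) where

    open GElt g using (aut; mat; invertible; preservesC)
    open FieldAut aut using (σ)

    g·_ : V → V
    g·_ = actG g

    lift : V → V
    lift v = mulMV mat (σV aut v)

    liftLine : V → V
    liftLine l = mulMV (cofactor mat) (σV aut l)

    lift≢0 : ∀ {v} → v ≢ zeroV → lift v ≢ zeroV
    lift≢0 v≢0 = mulMV≢0 invertible (σV≢0 aut v≢0)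

    liftLine≢0 : ∀ {l} → l ≢ zeroV → liftLine l ≢ zeroV
    liftLine≢0 l≢0 = cofactor≢0 invertible (σV≢0 aut l≢0)

    act-∝ : ∀ {v} → v ≢ zeroV → g· v ∝ lift v
    act-∝ {v} v≢0 = normalize-∝ (lift v) (lift≢0 v≢0)

    act∈points : ∀ {v} → v ≢ zeroV → g· v ∈ points
    act∈points v≢0 = normalize∈points (lift≢0 v≢0)

    liftLine-lift : ∀ l v → dotV (liftLine l) (lift v) ≡ det mat *F σ (dotV l v)
    liftLine-lift l v = trans (cofactor-dot mat (σV aut l) (σV aut v)) (cong (det mat *F_) (sym (σV-dot aut l v)))

    incident-act⁺ : ∀ {l v} → v ≢ zeroV → Incident l v → Incident (liftLine l) (g· v)
    incident-act⁺ {l} {v} v≢0 lv≡0 = incident-∝ʳ (act-∝ v≢0) (begin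
      dotV (liftLine l) (lift v)     ≡⟨ liftLine-lift l v ⟩
      det mat *F σ (dotV l v)        ≡⟨ cong (λ x → det mat *F σ x) lv≡0 ⟩
      det mat *F σ 0F                ≡⟨ cong (det mat *F_) (σ-0 aut) ⟩
      det mat *F 0F                  ≡⟨ zeroʳ _ ⟩
      0F                             ∎)
      where open ≡-Reasoning

    incident-act⁻ : ∀ {l v} → v ≢ zeroV → Incident (liftLine l) (g· v) → Incident l v
    incident-act⁻ {l} {v} v≢0 incident = σ≡0⇒≡0 aut (x*y≡0⇒y≡0 invertible
      (trans (sym (liftLine-lift l v)) (incident-∝ʳ (∝-sym (act-∝ v≢0)) incident)))

    act-injective : ∀ {x y} → x ∈ points → y ∈ points → g· x ≡ g· y → x ≡ y
    act-injective {x} {y} x∈ y∈ gx≡gy =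
      let k , k≢0 , lx≡k·ly = ∝-trans (∝-sym (act-∝ (point≢0 x∈))) (subst (_∝ lift y) (sym gx≡gy) (act-∝ (point≢0 y∈)))
      in ∝-points⇒≡ x∈ y∈ (σV-∝ aut k≢0 (mulMV-injective invertible
           (trans lx≡k·ly (sym (mulMV-scale mat k (σV aut y))))))

    act-surjective : ∀ {y} → y ∈ points → ∃[ x ] x ∈ points × g· x ≡ y
    act-surjective = pigeonhole _≟V_ g·_ points-Unique (act∈points ∘′ point≢0) act-injective

    act-conic : ∀ {P} → ConicPoint P → ConicPoint (g· P)
    act-conic {P} cP = onConic⇒ConicPoint (act∈points (point≢0 (conic∈points cP)))
      (from T-≡ (preservesC P (conic∈points cP) (to T-≡ (T-onConic cP))))

    act-conic-surjective : ∀ {Q} → ConicPoint Q → ∃[ P ] ConicPoint P × g· P ≡ Q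
    act-conic-surjective cQ =
      let P , P∈ , gP≡Q = pigeonhole _≟V_ g·_ (filterB-Unique onConic points-Unique)
                            (λ P∈ → conic⁺ (act-conic (conic⁻ P∈)))
                            (λ P∈ P′∈ → act-injective (proj₁ (∈-filterB⁻ _ points P∈))
                                                      (proj₁ (∈-filterB⁻ _ points P′∈)))
                            (conic⁺ cQ)
      in P , conic⁻ P∈ , gP≡Q
      where
      conic⁺ : ∀ {P} → ConicPoint P → P ∈ filterB onConic points
      conic⁺ cP = ∈-filterB⁺ onConic (conic∈points cP) (T-onConic cP)
      conic⁻ : ∀ {P} → P ∈ filterB onConic points → ConicPoint P
      conic⁻ P∈ = let P∈points , on = ∈-filterB⁻ onConic points P∈ in onConic⇒ConicPoint P∈points on

    liftLine-polar : ∀ {P} → ConicPoint P → liftLine (polar P) ∝ polar (g· P)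
    liftLine-polar {P} cP = tangent-is-polar (liftLine≢0 (polar≢0 cP)) (act-conic cP)
      (incident-act⁺ P≢0 (polar-self cP)) only
      where
      P≢0 : P ≢ zeroV
      P≢0 = point≢0 (conic∈points cP)
      only : MeetsConicOnlyAt (liftLine (polar P)) (g· P)
      only cz incident =
        let w , cw , gw≡z = act-conic-surjective cz
            w≢0 = point≢0 (conic∈points cw)
        in trans (sym gw≡z) (cong g·_ (polar-meets-conic-once cP cw
             (incident-act⁻ w≢0 (subst (Incident (liftLine (polar P))) (sym gw≡z) incident))))

    incident-polar-act⁺ : ∀ {P v} → ConicPoint P → v ≢ zeroV →
                          Incident (polar P) v → Incident (polar (g· P)) (g· v)
    incident-polar-act⁺ cP v≢0 Pv = incident-∝ˡ (∝-sym (liftLine-polar cP)) (incident-act⁺ v≢0 Pv)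

    incident-polar-act⁻ : ∀ {P v} → ConicPoint P → v ≢ zeroV →
                          Incident (polar (g· P)) (g· v) → Incident (polar P) v
    incident-polar-act⁻ cP v≢0 gPv = incident-act⁻ v≢0 (incident-∝ˡ (liftLine-polar cP) gPv)

    External-act⁻ : ∀ {x} → x ∈ points → External (g· x) → External x
    External-act⁻ {x} x∈ (external cQ cQ′ Q≢Q′ Qx Q′x) =
      let P , cP , gP≡Q = act-conic-surjective cQ
          P′ , cP′ , gP′≡Q′ = act-conic-surjective cQ′
      in external cP cP′ (λ P≡P′ → Q≢Q′ (trans (sym gP≡Q) (trans (cong g·_ P≡P′) gP′≡Q′)))
           (incident-polar-act⁻ cP (point≢0 x∈) (subst (λ R → Incident (polar R) (g· x)) (sym gP≡Q) Qx))
           (incident-polar-act⁻ cP′ (point≢0 x∈) (subst (λ R → Incident (polar R) (g· x)) (sym gP′≡Q′) Q′x))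

    ∈Ω-act⁻ : ∀ {x} → x ∈ points → g· x ∈ Ω → x ∈ Ω
    ∈Ω-act⁻ x∈ gx∈ = ∈Ω⁺ x∈ (External-act⁻ x∈ (proj₂ (∈Ω⁻ gx∈)))

  affinePoints : List V
  affinePoints = concatMap (λ b → map (λ c → 1F , b , c) elems) elems

  idealPoints : List V
  idealPoints = map (λ c → 0F , 1F , c) elems ++ (0F , 0F , 1F) ∷ []

  ∈affinePoints⁻ : ∀ {v} → v ∈ affinePoints → coord₀ v ≡ 1F
  ∈affinePoints⁻ v∈ = let _ , _ , v∈′ = ∈-concatMap⁻ _ elems v∈ ; _ , _ , v≡ = ∈-map⁻ _ v∈′ in cong coord₀ v≡

  ∈idealPoints⁻ : ∀ {v} → v ∈ idealPoints → coord₀ v ≡ 0F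
  ∈idealPoints⁻ v∈ with ++⁻ (map (λ c → 0F , 1F , c) elems) v∈
  ... | inj₁ v∈′ = let _ , _ , v≡ = ∈-map⁻ _ v∈′ in cong coord₀ v≡
  ... | inj₂ (here refl) = refl

  countB-points-canonical : ∀ (p : V → Bool) → countB p points ≡ countB p (affinePoints ++ idealPoints)
  countB-points-canonical p = Unique-⊆-⊇⇒length≡ (filterB-Unique p points-Unique) (filterB-Unique p canonical-Unique)
    (λ v∈ → let v∈points , pv = ∈-filterB⁻ p points v∈ in ∈-filterB⁺ p (canonical⁺ (∈points⁻ v∈points)) pv)
    (λ v∈ → let v∈canonical , pv = ∈-filterB⁻ p _ v∈ in ∈-filterB⁺ p (∈points⁺ (canonical⁻ v∈canonical)) pv)
    where
    canonical⁺ : ∀ {v} → Canonical v → v ∈ affinePoints ++ idealPoints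
    canonical⁺ (affine b c) = ++⁺ˡ (∈-concatMap⁺ _ (∈-map⁺ _ (complete c)) (complete b))
    canonical⁺ (ideal c) = ++⁺ʳ affinePoints (++⁺ˡ (∈-map⁺ _ (complete c)))
    canonical⁺ ideal∞ = ++⁺ʳ affinePoints (++⁺ʳ (map _ elems) (here refl))
    canonical⁻ : ∀ {v} → v ∈ affinePoints ++ idealPoints → Canonical v
    canonical⁻ v∈ with ++⁻ affinePoints v∈
    ... | inj₁ v∈a = let b , _ , v∈′ = ∈-concatMap⁻ _ elems v∈a ; c , _ , v≡ = ∈-map⁻ _ v∈′ in
      subst Canonical (sym v≡) (affine b c)
    ... | inj₂ v∈i with ++⁻ (map (λ c → 0F , 1F , c) elems) v∈i
    ...   | inj₁ v∈′ = let c , _ , v≡ = ∈-map⁻ _ v∈′ in subst Canonical (sym v≡) (ideal c)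
    ...   | inj₂ (here refl) = ideal∞
    canonical-Unique : Unique (affinePoints ++ idealPoints)
    canonical-Unique = Unique.++⁺ affine-Unique ideal-Unique
      (λ (v∈a , v∈i) → 0≢1 (trans (sym (∈idealPoints⁻ v∈i)) (∈affinePoints⁻ v∈a)))
      where
      affine-Unique : Unique affinePoints
      affine-Unique = concatMap-Unique _ unique (λ b → Unique.map⁺ (cong coord₂) unique)
        λ v∈ v∈′ → let _ , _ , v≡ = ∈-map⁻ _ v∈ ; _ , _ , v≡′ = ∈-map⁻ _ v∈′ in
                   trans (sym (cong coord₁ v≡)) (cong coord₁ v≡′)
      ideal-Unique : Unique idealPoints
      ideal-Unique = Unique.++⁺ (Unique.map⁺ (cong coord₂) unique) ([] ∷ [])
        λ { (v∈ , here v≡∞) → let _ , _ , v≡ = ∈-map⁻ _ v∈ in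
                                1≢0 (trans (sym (cong coord₁ v≡)) (cong coord₁ v≡∞)) }

  countB-points : ∀ (p : V → Bool) → countB p points ≡
    sum (map (λ b → countB (λ c → p (1F , b , c)) elems) elems)
      + (countB (λ c → p (0F , 1F , c)) elems + countB p ((0F , 0F , 1F) ∷ []))
  countB-points p = begin
    countB p points                                ≡⟨ countB-points-canonical p ⟩
    countB p (affinePoints ++ idealPoints)         ≡⟨ countB-++ p affinePoints idealPoints ⟩
    countB p affinePoints + countB p idealPoints   ≡⟨ cong₂ _+_ affine-count ideal-count ⟩
    sum (map (λ b → countB (λ c → p (1F , b , c)) elems) elems)
      + (countB (λ c → p (0F , 1F , c)) elems + countB p ((0F , 0F , 1F) ∷ [])) ∎
    where
    open ≡-Reasoning
    affine-count : countB p affinePoints ≡ sum (map (λ b → countB (λ c → p (1F , b , c)) elems) elems)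
    affine-count = trans (countB-concatMap p _ elems)
                         (sum-cong elems (λ {b} _ → countB-map p (λ c → 1F , b , c) elems))
    ideal-count : countB p idealPoints ≡ countB (λ c → p (0F , 1F , c)) elems + countB p ((0F , 0F , 1F) ∷ [])
    ideal-count = trans (countB-++ p (map (λ c → 0F , 1F , c) elems) _)
                        (cong (_+ countB p ((0F , 0F , 1F) ∷ [])) (countB-map p _ elems))

  χ-nontrivial : ∀ (S : Subset) {x y} → x ∈ Ω → y ∈ Ω → T (S x) → ¬ T (S y) → 2 ≤ card S →
                 Nontrivial (χ S)
  χ-nontrivial S {x} {y} x∈ y∈ Sx ¬Sy 2≤|S| = (x , y , x∈ , y∈ , χx≢χy) , (begin
    countB (λ v → χ S v ℕ.≡ᵇ 0) Ω + 2    ≡⟨ cong (_+ 2) (countB-cong Ω (λ {v} _ → χ≡ᵇ0 (S v))) ⟩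
    countB (not ∘′ S) Ω + 2              ≤⟨ ℕ.+-monoʳ-≤ (countB (not ∘′ S) Ω) 2≤|S| ⟩
    countB (not ∘′ S) Ω + countB S Ω     ≡⟨ ℕ.+-comm _ (countB S Ω) ⟩
    countB S Ω + countB (not ∘′ S) Ω     ≡⟨ countB+countB-not S Ω ⟩
    length Ω                             ∎)
    where
    open ℕ.≤-Reasoning
    χx≢χy : χ S x ≢ χ S y
    χx≢χy χx≡χy = ℕ.1+n≢0 (trans (sym (χ≡1 Sx)) (trans χx≡χy (χ≡0 ¬Sy)))
    χ≡ᵇ0 : ∀ b → ((if b then 1 else 0) ℕ.≡ᵇ 0) ≡ not b
    χ≡ᵇ0 true  = refl
    χ≡ᵇ0 false = refl

  data ΩPoint : V → Set where
    affineΩ : ∀ {b c} → NonzeroSquare (b *F b − c) → ΩPoint (1F , b , c)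
    idealΩ  : ∀ c → ΩPoint (0F , 1F , c)

  ∈Ω⇒ΩPoint : ∀ {x} → x ∈ Ω → ΩPoint x
  ∈Ω⇒ΩPoint x∈ = let x∈points , ext = ∈Ω⁻ x∈ in go (∈points⁻ x∈points) ext
    where
    go : ∀ {x} → Canonical x → External x → ΩPoint x
    go (affine b c) ext = affineΩ (external-affine⁻ ext)
    go (ideal c)    _   = idealΩ c
    go ideal∞       ext = ⊥-elim (¬external-ideal∞ ext)

  nonzeroSquares : ℕ
  nonzeroSquares = countB isNonzeroSquare elems

  1≤nonzeroSquares : 1 ≤ nonzeroSquares
  1≤nonzeroSquares = 1≤countB _ elems (complete 1F) (T-isNonzeroSquare⁺ (1≢0 , 1F , *-idˡ 1F))

  countB-nonzeroSquare-shift : ∀ b → countB (λ c → isNonzeroSquare (b *F b − c)) elems ≡ nonzeroSquares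
  countB-nonzeroSquare-shift b = countB-involution isNonzeroSquare (b *F b −_) unique complete
    (λ c → solve 2 (λ b c → b :* b :- (b :* b :- c) := c) refl b c)

  tangent∞ : Subset
  tangent∞ v = coord₀ v ==F 0F

  secant+pole : Subset
  secant+pole v = (coord₁ v ==F 0F) ∨ (v ==V (0F , 1F , 0F))

  secant+pole-affine⁻ : ∀ {b c} → T (secant+pole (1F , b , c)) → b ≡ 0F
  secant+pole-affine⁻ {b} {c} A with to T-∨ A
  ... | inj₁ b≡0 = T-does⁻ (b ≟F 0F) b≡0
  ... | inj₂ pole = ⊥-elim (1≢0 (cong coord₀ (T-does⁻ ((1F , b , c) ≟V (0F , 1F , 0F)) pole)))

  secant+pole-affine⁺ : ∀ {c} → T (secant+pole (1F , 0F , c))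
  secant+pole-affine⁺ = from T-∨ (inj₁ (T-does⁺ (0F ≟F 0F) refl))

  secant+pole-ideal⁻ : ∀ {c} → T (secant+pole (0F , 1F , c)) → c ≡ 0F
  secant+pole-ideal⁻ {c} A with to T-∨ A
  ... | inj₁ 1≡0 = ⊥-elim (1≢0 (T-does⁻ (1F ≟F 0F) 1≡0))
  ... | inj₂ pole = cong coord₂ (T-does⁻ ((0F , 1F , c) ≟V (0F , 1F , 0F)) pole)

  secant+pole-pole : T (secant+pole (0F , 1F , 0F))
  secant+pole-pole = from T-∨ (inj₂ (T-does⁺ ((0F , 1F , 0F) ≟V (0F , 1F , 0F)) refl))

  module _ (1+1≢0 : 1F +F 1F ≢ 0F) where

    external-affine⁺ : ∀ {b c} → NonzeroSquare (b *F b − c) → External (1F , b , c)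
    external-affine⁺ {b} {c} (d≢0 , r , rr≡d) = external (conic (b +F r)) (conic (b − r)) distinct
      (incident-polar-conic⁺ (trans (solve 2 (λ b r → ((b :+ r) :- b) :* ((b :+ r) :- b) := r :* r) refl b r) rr≡d))
      (incident-polar-conic⁺ (trans (solve 2 (λ b r → ((b :- r) :- b) :* ((b :- r) :- b) := r :* r) refl b r) rr≡d))
      where
      distinct : (1F , b +F r , (b +F r) *F (b +F r)) ≢ (1F , b − r , (b − r) *F (b − r))
      distinct P≡P′ = d≢0 (trans (sym rr≡d) (trans (cong (λ x → x *F x) r≡0) (zeroʳ 0F)))
        where
        r≡0 : r ≡ 0F
        r≡0 = x*y≡0⇒y≡0 1+1≢0 (trans (solve 2 (λ b r → (con 1ℤ :+ con 1ℤ) :* r := (b :+ r) :- (b :- r)) refl b r)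
                                     (x≡y⇒x−y≡0 (cong coord₁ P≡P′)))


    external-ideal : ∀ c → External (0F , 1F , c)
    external-ideal c = external conic∞ (conic t) (λ P≡P′ → 0≢1 (cong coord₀ P≡P′)) (polar-conic∞ 0F 1F c) (begin
      dotV (polar (1F , t , t *F t)) (0F , 1F , c)   ≡⟨ polar-conic t 0F 1F c ⟩
      (t *F t) *F 0F − (t +F t) *F 1F +F c           ≡⟨ solve 2 (λ c h → ((c :* h) :* (c :* h)) :* con 0ℤ
                                                                       :- ((c :* h) :+ (c :* h)) :* con 1ℤ :+ c
                                                              := c :* (con 1ℤ :- (con 1ℤ :+ con 1ℤ) :* h)) refl c ½ ⟩
      c *F (1F − (1F +F 1F) *F ½)                    ≡⟨ cong (λ x → c *F (1F − x)) (*-invʳ _ 1+1≢0) ⟩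
      c *F (1F − 1F)                                 ≡⟨ solve 1 (λ c → c :* (con 1ℤ :- con 1ℤ) := con 0ℤ) refl c ⟩
      0F                                             ∎)
      where
      open ≡-Reasoning
      ½ t : F
      ½ = invF (1F +F 1F)
      t = c *F ½

    ΩPoint⇒∈Ω : ∀ {x} → ΩPoint x → x ∈ Ω
    ΩPoint⇒∈Ω (affineΩ {b} {c} sq) = ∈Ω⁺ (∈points⁺ (affine b c)) (external-affine⁺ sq)
    ΩPoint⇒∈Ω (idealΩ c)          = ∈Ω⁺ (∈points⁺ (ideal c)) (external-ideal c)

    isExternal-affine : ∀ b c → isExternal (1F , b , c) ≡ isNonzeroSquare (b *F b − c)
    isExternal-affine b c = bool-ext (T-isNonzeroSquare⁺ ∘′ external-affine⁻ ∘′ isExternal⁻)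
                                     (isExternal⁺ ∘′ external-affine⁺ ∘′ T-isNonzeroSquare⁻)

    length-Ω : length Ω ≡ order * suc nonzeroSquares
    length-Ω = begin
      countB isExternal points
        ≡⟨ countB-points isExternal ⟩
      sum (map (λ b → countB (λ c → isExternal (1F , b , c)) elems) elems)
        + (countB (λ c → isExternal (0F , 1F , c)) elems + countB isExternal ((0F , 0F , 1F) ∷ []))
        ≡⟨ cong₂ _+_ affine-part (cong₂ _+_ ideal-part ideal∞-part) ⟩
      order * nonzeroSquares + (order + 0)
        ≡⟨ cong (order * nonzeroSquares +_) (ℕ.+-identityʳ order) ⟩
      order * nonzeroSquares + order
        ≡⟨ ℕ.+-comm _ order ⟩
      order + order * nonzeroSquares
        ≡⟨ ℕ.*-suc order nonzeroSquares ⟨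
      order * suc nonzeroSquares ∎
      where
      open ≡-Reasoning
      affine-part : sum (map (λ b → countB (λ c → isExternal (1F , b , c)) elems) elems)
                    ≡ order * nonzeroSquares
      affine-part = trans (sum-cong elems (λ {b} _ → trans (countB-cong elems (λ {c} _ → isExternal-affine b c))
                                                          (countB-nonzeroSquare-shift b)))
                          (sum-const nonzeroSquares elems)
      ideal-part : countB (λ c → isExternal (0F , 1F , c)) elems ≡ order
      ideal-part = trans (countB-cong elems (λ {c} _ → to T-≡ (isExternal⁺ (external-ideal c))))
                         (countB-const-true elems)
      ideal∞-part : countB isExternal ((0F , 0F , 1F) ∷ []) ≡ 0
      ideal∞-part =
        countB≡0 isExternal ((0F , 0F , 1F) ∷ []) λ { (here refl) → ¬external-ideal∞ ∘′ isExternal⁻ }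

    card-tangent∞ : card tangent∞ ≡ order
    card-tangent∞ = begin
      countB tangent∞ Ω
        ≡⟨ countB-filterB isExternal tangent∞ points ⟩
      countB B′ points
        ≡⟨ countB-points B′ ⟩
      sum (map (λ b → countB (λ c → B′ (1F , b , c)) elems) elems)
        + (countB (λ c → B′ (0F , 1F , c)) elems + countB B′ ((0F , 0F , 1F) ∷ []))
        ≡⟨ cong₂ _+_ affine-part (cong₂ _+_ ideal-part ideal∞-part) ⟩
      0 + (order + 0)
        ≡⟨ ℕ.+-identityʳ order ⟩
      order ∎
      where
      open ≡-Reasoning
      B′ : V → Bool
      B′ v = isExternal v ∧ tangent∞ v
      affine-part : sum (map (λ b → countB (λ c → B′ (1F , b , c)) elems) elems) ≡ 0
      affine-part = sum≡0 _ elems λ {b} _ → countB≡0 _ elems λ {c} _ B →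
        1≢0 (T-does⁻ (1F ≟F 0F) (proj₂ (to (T-∧ {isExternal (1F , b , c)}) B)))
      ideal-part : countB (λ c → B′ (0F , 1F , c)) elems ≡ order
      ideal-part = trans (countB-cong elems (λ {c} _ → to T-≡
                           (from T-∧ (isExternal⁺ (external-ideal c) , T-does⁺ (0F ≟F 0F) refl))))
                         (countB-const-true elems)
      ideal∞-part : countB B′ ((0F , 0F , 1F) ∷ []) ≡ 0
      ideal∞-part = countB≡0 B′ ((0F , 0F , 1F) ∷ [])
        λ { (here refl) B → ¬external-ideal∞ (isExternal⁻ (proj₁ (to T-∧ B))) }

    card-secant+pole : card secant+pole ≡ suc nonzeroSquares
    card-secant+pole = begin
      countB secant+pole Ω
        ≡⟨ countB-filterB isExternal secant+pole points ⟩
      countB A′ points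
        ≡⟨ countB-points A′ ⟩
      sum (map (λ b → countB (λ c → A′ (1F , b , c)) elems) elems)
        + (countB (λ c → A′ (0F , 1F , c)) elems + countB A′ ((0F , 0F , 1F) ∷ []))
        ≡⟨ cong₂ _+_ affine-part (cong₂ _+_ ideal-part ideal∞-part) ⟩
      nonzeroSquares + (1 + 0)
        ≡⟨ ℕ.+-comm nonzeroSquares 1 ⟩
      suc nonzeroSquares ∎
      where
      open ≡-Reasoning
      A′ : V → Bool
      A′ v = isExternal v ∧ secant+pole v
      affine-part : sum (map (λ b → countB (λ c → A′ (1F , b , c)) elems) elems) ≡ nonzeroSquares
      affine-part = begin
        sum (map (λ b → countB (λ c → A′ (1F , b , c)) elems) elems)
          ≡⟨ sum-single _ elems unique (complete 0F) (λ {b} _ b≢0 → countB≡0 _ elems λ {c} _ A →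
               b≢0 (secant+pole-affine⁻ (proj₂ (to (T-∧ {isExternal (1F , b , c)}) A)))) ⟩
        countB (λ c → A′ (1F , 0F , c)) elems
          ≡⟨ countB-cong elems (λ {c} _ → trans (cong (isExternal (1F , 0F , c) ∧_) (to T-≡ secant+pole-affine⁺))
                                               (trans (∧-identityʳ _) (isExternal-affine 0F c))) ⟩
        countB (λ c → isNonzeroSquare (0F *F 0F − c)) elems
          ≡⟨ countB-nonzeroSquare-shift 0F ⟩
        nonzeroSquares ∎
      ideal-part : countB (λ c → A′ (0F , 1F , c)) elems ≡ 1
      ideal-part = countB≡1 _ unique (complete 0F) (from T-∧ (isExternal⁺ (external-ideal 0F) , secant+pole-pole))
                     λ {c} _ A → secant+pole-ideal⁻ (proj₂ (to (T-∧ {isExternal (0F , 1F , c)}) A))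
      ideal∞-part : countB A′ ((0F , 0F , 1F) ∷ []) ≡ 0
      ideal∞-part = countB≡0 A′ ((0F , 0F , 1F) ∷ [])
        λ { (here refl) A → ¬external-ideal∞ (isExternal⁻ (proj₁ (to T-∧ A))) }

    OnlyPointOf : (V → Bool) → V → V → Set
    OnlyPointOf S l m =
      m ∈ Ω × T (S m) × Incident l m × (∀ {x} → x ∈ Ω → T (S x) → Incident l x → x ≡ m)

    pole : V
    pole = 0F , 1F , 0F

    pole-only-on-tangent∞ : OnlyPointOf secant+pole (polar (0F , 0F , 1F)) pole
    pole-only-on-tangent∞ =
      ΩPoint⇒∈Ω (idealΩ 0F) , secant+pole-pole , polar-conic∞ 0F 1F 0F , λ x∈ → only (∈Ω⇒ΩPoint x∈)
      where
      only : ∀ {x} → ΩPoint x → T (secant+pole x) → Incident (polar (0F , 0F , 1F)) x → x ≡ pole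
      only (affineΩ {b} {c} _) _ Qx = ⊥-elim (1≢0 (trans (sym (polar-conic∞ 1F b c)) Qx))
      only (idealΩ c)          A _  = cong (λ c → 0F , 1F , c) (secant+pole-ideal⁻ A)

    pole-only-on-tangent₀ : OnlyPointOf secant+pole (polar (1F , 0F , 0F *F 0F)) pole
    pole-only-on-tangent₀ =
      ΩPoint⇒∈Ω (idealΩ 0F) , secant+pole-pole , Q-pole , λ x∈ → only (∈Ω⇒ΩPoint x∈)
      where
      Q-pole : Incident (polar (1F , 0F , 0F *F 0F)) pole
      Q-pole = trans (polar-conic 0F 0F 1F 0F)
        (solve 0 ((con 0ℤ :* con 0ℤ) :* con 0ℤ :- (con 0ℤ :+ con 0ℤ) :* con 1ℤ :+ con 0ℤ := con 0ℤ) refl)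
      only : ∀ {x} → ΩPoint x → T (secant+pole x) → Incident (polar (1F , 0F , 0F *F 0F)) x → x ≡ pole
      only (affineΩ {b} {c} (d≢0 , _)) A Qx with secant+pole-affine⁻ A
      ... | refl = ⊥-elim (d≢0 (trans (sym (incident-polar-conic⁻ Qx))
                                  (solve 0 ((con 0ℤ :- con 0ℤ) :* (con 0ℤ :- con 0ℤ) := con 0ℤ) refl)))
      only (idealΩ c) A _ = cong (λ c → 0F , 1F , c) (secant+pole-ideal⁻ A)

    -- The tangent at (1, t, t²) meets the secant X₁ = 0 in (1, 0, -t²), external since t ≠ 0.
    affine-only-on-tangent : ∀ {t} → t ≢ 0F →
                             OnlyPointOf secant+pole (polar (1F , t , t *F t)) (1F , 0F , -F (t *F t))
    affine-only-on-tangent {t} t≢0 =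
      ΩPoint⇒∈Ω (affineΩ square) , secant+pole-affine⁺ , Qm , λ x∈ → only (∈Ω⇒ΩPoint x∈)
      where
      open ≡-Reasoning
      m : V
      m = 1F , 0F , -F (t *F t)
      0−m≡tt : 0F *F 0F − (-F (t *F t)) ≡ t *F t
      0−m≡tt = solve 1 (λ t → con 0ℤ :* con 0ℤ :- (:- (t :* t)) := t :* t) refl t
      square : NonzeroSquare (0F *F 0F − (-F (t *F t)))
      square = (λ ≡0 → *-nonzero t≢0 t≢0 (trans (sym 0−m≡tt) ≡0)) , t , sym 0−m≡tt
      Qm : Incident (polar (1F , t , t *F t)) m
      Qm = incident-polar-conic⁺
             (trans (solve 1 (λ t → (t :- con 0ℤ) :* (t :- con 0ℤ) := t :* t) refl t) (sym 0−m≡tt))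
      only : ∀ {x} → ΩPoint x → T (secant+pole x) → Incident (polar (1F , t , t *F t)) x → x ≡ m
      only (affineΩ {b} {c} _) A Qx with secant+pole-affine⁻ A
      ... | refl = cong (λ c → 1F , 0F , c) (x−y≡0⇒x≡y (begin
        c − (-F (t *F t))                          ≡⟨ solve 2 (λ c t → c :- (:- (t :* t))
                                                         := (t :- con 0ℤ) :* (t :- con 0ℤ) :- (con 0ℤ :* con 0ℤ :- c)) refl c t ⟩
        (t − 0F) *F (t − 0F) − (0F *F 0F − c)      ≡⟨ x≡y⇒x−y≡0 (incident-polar-conic⁻ Qx) ⟩
        0F                                         ∎))
      only (idealΩ c) A Qx = ⊥-elim (t≢0 (x*y≡0⇒y≡0 1+1≢0 (begin
        (1F +F 1F) *F t                                  ≡⟨ solve 2 (λ t c → (con 1ℤ :+ con 1ℤ) :* t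
                                                               := :- ((t :* t) :* con 0ℤ :- (t :+ t) :* con 1ℤ :+ c) :+ c) refl t c ⟩
        -F ((t *F t) *F 0F − (t +F t) *F 1F +F c) +F c  ≡⟨ cong₂ (λ d c → -F d +F c) (trans (sym (polar-conic t 0F 1F c)) Qx)
                                                                                      (secant+pole-ideal⁻ A) ⟩
        -F 0F +F 0F                                      ≡⟨ solve 0 (:- con 0ℤ :+ con 0ℤ := con 0ℤ) refl ⟩
        0F                                               ∎)))

    tangent-meets-secant+pole-once : ∀ {Q} → ConicPoint Q → ∃[ m ] OnlyPointOf secant+pole (polar Q) m
    tangent-meets-secant+pole-once conic∞ = pole , pole-only-on-tangent∞
    tangent-meets-secant+pole-once (conic t) with t ≟F 0F
    ... | yes refl = pole , pole-only-on-tangent₀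
    ... | no t≢0   = _ , affine-only-on-tangent t≢0

    tangent∞⇒incident : ∀ {b} → T (tangent∞ b) → Incident (polar (0F , 0F , 1F)) b
    tangent∞⇒incident {x , y , z} B = trans (polar-conic∞ x y z) (T-does⁻ (x ≟F 0F) B)

    incident⇒tangent∞ : ∀ {b} → Incident (polar (0F , 0F , 1F)) b → T (tangent∞ b)
    incident⇒tangent∞ {x , y , z} ∞b = T-does⁺ (x ≟F 0F) (trans (sym (polar-conic∞ x y z)) ∞b)

    module _ (g : GElt) where

      image-tangent∞⁻ : ∀ {x} → T (imageSet g tangent∞ x) → Incident (polar (actG g (0F , 0F , 1F))) x
      image-tangent∞⁻ {x} img =
        let b , b∈ , hit = any-elim (λ b → tangent∞ b ∧ (actG g b ==V x)) Ω img
            Bb , gb≡x = to (T-∧ {tangent∞ b}) hit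
        in
        subst (Incident (polar (actG g (0F , 0F , 1F)))) (T-does⁻ (actG g b ≟V x) gb≡x)
          (incident-polar-act⁺ g conic∞ (point≢0 (proj₁ (∈Ω⁻ b∈))) (tangent∞⇒incident Bb))

      image-tangent∞⁺ : ∀ {x} → x ∈ Ω → Incident (polar (actG g (0F , 0F , 1F))) x →
                        T (imageSet g tangent∞ x)
      image-tangent∞⁺ {x} x∈ gQx =
        let b , b∈ , gb≡x = act-surjective g (proj₁ (∈Ω⁻ x∈)) in
        any-intro (λ b → tangent∞ b ∧ (actG g b ==V x)) (∈Ω-act⁻ g b∈ (subst (_∈ Ω) (sym gb≡x) x∈))
          (from (T-∧ {tangent∞ b}) (incident⇒tangent∞ (incident-polar-act⁻ g conic∞ (point≢0 b∈)
                  (subst (Incident (polar (actG g (0F , 0F , 1F)))) (sym gb≡x) gQx)) ,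
               T-does⁺ (actG g b ≟V x) gb≡x))

      secant+pole-meets-image : countB (λ x → secant+pole x ∧ imageSet g tangent∞ x) Ω ≡ 1
      secant+pole-meets-image =
        let m , m∈ , Am , Qm , only = tangent-meets-secant+pole-once (act-conic g conic∞) in
        countB≡1 _ Ω-Unique m∈ (from T-∧ (Am , image-tangent∞⁺ m∈ Qm))
          λ x∈ hit → let Ax , img = to T-∧ hit in only x∈ Ax (image-tangent∞⁻ img)

    2≤|secant+pole| : 2 ≤ card secant+pole
    2≤|secant+pole| = subst (2 ≤_) (sym card-secant+pole) (s≤s 1≤nonzeroSquares)

    |secant+pole|*|tangent∞|≡|Ω| : card secant+pole * card tangent∞ ≡ length Ω
    |secant+pole|*|tangent∞|≡|Ω| = begin
      card secant+pole * card tangent∞   ≡⟨ cong₂ _*_ card-secant+pole card-tangent∞ ⟩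
      suc nonzeroSquares * order         ≡⟨ ℕ.*-comm (suc nonzeroSquares) order ⟩
      order * suc nonzeroSquares         ≡⟨ length-Ω ⟨
      length Ω                           ∎
      where open ≡-Reasoning

    module _ (2≤q : 2 ≤ order) where

      2≤|tangent∞| : 2 ≤ card tangent∞
      2≤|tangent∞| = subst (2 ≤_) (sym card-tangent∞) 2≤q

      nonseparating : Nonseparating
      nonseparating = secant+pole , tangent∞ , 2≤|secant+pole| , 2≤|tangent∞| ,
                      |secant+pole|*|tangent∞|≡|Ω| , secant+pole-meets-image

      nonspreading : Nonspreading
      nonspreading = χ secant+pole , tangent∞ , 1 ,
        χ-nontrivial secant+pole (ΩPoint⇒∈Ω (idealΩ 0F)) (ΩPoint⇒∈Ω (idealΩ 1F))
                     secant+pole-pole (1≢0 ∘′ secant+pole-ideal⁻) 2≤|secant+pole| ,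
        χ-nontrivial tangent∞ (ΩPoint⇒∈Ω (idealΩ 0F)) (ΩPoint⇒∈Ω (affineΩ square))
                     (T-does⁺ (0F ≟F 0F) refl) (1≢0 ∘′ T-does⁻ (1F ≟F 0F)) 2≤|tangent∞| ,
        s≤s z≤n ,
        subst₂ _∣_ (sym (sum-χ secant+pole Ω)) |secant+pole|*|tangent∞|≡|Ω| (m∣m*n (card tangent∞)) ,
        λ g → trans (sum-χ*χ secant+pole (imageSet g tangent∞) Ω) (secant+pole-meets-image g)
        where
        square : NonzeroSquare (0F *F 0F − (-F 1F))
        square = (λ ≡0 → 1≢0 (trans (sym 0−-1≡1) ≡0)) , 1F , trans (*-idˡ 1F) (sym 0−-1≡1)
          where
          0−-1≡1 : 0F *F 0F − (-F 1F) ≡ 1F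
          0−-1≡1 = solve 0 (con 0ℤ :* con 0ℤ :- (:- con 1ℤ) := con 1ℤ) refl

lemma6p2 : (𝔽 : FiniteField) → FiniteField.order 𝔽 % 2 ≡ 1 → 5 ≤ FiniteField.order 𝔽 →
    PG2.Nonseparating 𝔽 × PG2.Nonspreading 𝔽
lemma6p2 𝔽 odd 5≤q = nonseparating 𝔽 (odd⇒1+1≢0 𝔽 odd) 2≤q , nonspreading 𝔽 (odd⇒1+1≢0 𝔽 odd) 2≤q
  where
  2≤q : 2 ≤ FiniteField.order 𝔽
  2≤q = ℕ.≤-trans (s≤s (s≤s z≤n)) 5≤q
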